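{- For any fixed integers $j,k,m$ with $j\ge2$, define $\phi_{j,k,m}(n)=m(2^n-1)+k$ for $1\le n\le j$ and $\phi_{j,k,m}(n)=\left(\sum_{i=1}^j\phi_{j,k,m}(n-i)\right)-(j-1)k$ for $n>j$. Then $\Phi_1(\phi_{j,k,m},n)\equiv 0\pmod n$ for all positive integers $n$.
   Context: For an integer-valued function $\phi$ on the positive integers, $\Phi_1(\phi,n)=\sum_{d\mid n}\mu(d)\phi(n/d)$, where $\mu$ is the Möbius function; equivalently $\Phi_1(\phi,1)=\phi(1)$ and for $n=p_1^{k_1}\cdots p_r^{k_r}$ (distinct primes $p_i$) $\Phi_1(\phi,n)=\phi(n)-\sum_i\phi(n/p_i)+\sum_{i_1<i_2}\phi(n/(p_{i_1}p_{i_2}))-\cdots+(-1)^r\phi(n/(p_1\cdots p_r))$. -}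

module Defs where

open import Data.Nat as ℕ using (ℕ; zero; suc; _≤?_)
open import Data.Nat.Divisibility using (_∣?_)
open import Data.Nat.DivMod using (_/_)
open import Data.Nat.Primality using (prime?)
open import Data.Integer as ℤ using (ℤ; +_; _-_; _+_; _*_; -_)
open import Data.List using (List; []; _∷_; length; filter; map; upTo; take; foldr)
open import Data.List.Relation.Unary.All using (all?)
open import Relation.Nullary using (yes; no; ¬?)
open import Relation.Nullary.Decidable using (⌊_⌋; _×-dec_)

sumℤ : List ℤ → ℤ
sumℤ = foldr _+_ (+ 0)

ω : ℕ → ℕ
ω d = length (filter (λ p → prime? p ×-dec (p ∣? d)) (upTo (suc d)))

squarefree? : (d : ℕ) → _
squarefree? d = all? (λ i → ¬? ((suc (suc i) ℕ.* suc (suc i)) ∣? d)) (upTo d)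

-- Möbius function μ : ℕ → ℤ (value at 0 irrelevant)
μ : ℕ → ℤ
μ d with squarefree? d
... | yes _ = (- (+ 1)) ℤ.^ ω d
... | no _  = + 0

-- Φ₁(φ, n) = Σ_{d ∣ n} μ(d) φ(n/d), for n ≥ 1 (d ranges over 1..n)
Φ₁ : (ℕ → ℤ) → ℕ → ℤ
Φ₁ φ n = sumℤ (map (λ i → μ (suc i) * φ (n / suc i))
                   (filter (λ i → suc i ∣? n) (upTo n)))

-- values [φ(n), φ(n-1), …, φ(1)] of φ_{j,k,m} (latest first)
φvals : ℕ → ℤ → ℤ → ℕ → List ℤ
φvals j k m zero = []
φvals j k m (suc n) with suc n ≤? j
... | yes _ = (m * ((+ (2 ℕ.^ suc n)) - + 1) + k) ∷ φvals j k m n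
... | no _  = (sumℤ (take j (φvals j k m n)) - (+ (j ℕ.∸ 1)) * k) ∷ φvals j k m n

-- φ_{j,k,m}(n) for n ≥ 1 (value at 0 is an irrelevant default 0)
φjkm : ℕ → ℤ → ℤ → ℕ → ℤ
φjkm j k m n with φvals j k m n
... | []    = + 0
... | x ∷ _ = x

-- φ_{j,k,m} = m·s + k, where s(n) is the trace of the n-th power of the companion matrix of
-- x^j − x^(j−1) − ⋯ − 1 (the j-step Lucas numbers). Realising this matrix as a finite automaton on
-- binary words, s(n) counts pairs (w, c) of a word of length n and a state c fixed by w. Among the words
-- of length p·L, L = p^e·r, those of period L contribute exactly s(L), and rotation by r acts freely on
-- the others with orbits of size p^(e+1); so s, and with it φ, satisfies the Euler congruences
-- φ(p^(e+1) r) ≡ φ(p^e r) mod p^(e+1). In Σ_{d∣n} μ(d) φ(n/d) with n = p^(e+1) m, p ∤ m, the terms at d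
-- and p·d (p ∤ d) pair up into multiples of p^(e+1), and these prime-power divisibilities give n ∣ Φ₁(φ, n).

module Submission where

open import Algebra.Bundles using (CommutativeMonoid)
open import Data.Nat.Base using (ℕ; _<_; NonZero)
import Data.Nat.Base as ℕ
open import Data.Integer.Base using (ℤ)
open import Relation.Binary.PropositionalEquality.Core using (_≡_)
open import Defs

module RangeSum {c ℓ} (M : CommutativeMonoid c ℓ) where

  open import Data.Nat using (zero; suc; _+_; _*_; _∸_; _≤_; z≤n; s≤s)
  open import Data.Nat.Properties using (m+[n∸m]≡n; m≤m+n; +-monoʳ-<; +-assoc; suc-injective)
  open import Relation.Binary.PropositionalEquality as ≡ using (_≢_; cong; subst)
  open CommutativeMonoid M renaming (Carrier to A)
  open import Algebra.Properties.CommutativeSemigroup commutativeSemigroup using (interchange)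
  open import Relation.Binary.Reasoning.Setoid setoid

  ∑ : ℕ → (ℕ → A) → A
  ∑ zero    f = ε
  ∑ (suc n) f = f 0 ∙ ∑ n (λ i → f (suc i))

  ∑-cong : ∀ n {f g : ℕ → A} → (∀ i → i < n → f i ≈ g i) → ∑ n f ≈ ∑ n g
  ∑-cong zero    f≈g = refl
  ∑-cong (suc n) f≈g = ∙-cong (f≈g 0 (s≤s z≤n)) (∑-cong n (λ i i<n → f≈g (suc i) (s≤s i<n)))

  ∑-distrib : ∀ n (f g : ℕ → A) → ∑ n (λ i → f i ∙ g i) ≈ ∑ n f ∙ ∑ n g
  ∑-distrib zero    f g = sym (identityˡ ε)
  ∑-distrib (suc n) f g = begin
    (f 0 ∙ g 0) ∙ ∑ n (λ i → f (suc i) ∙ g (suc i))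
      ≈⟨ ∙-congˡ (∑-distrib n _ _) ⟩
    (f 0 ∙ g 0) ∙ (∑ n (λ i → f (suc i)) ∙ ∑ n (λ i → g (suc i)))
      ≈⟨ interchange _ _ _ _ ⟩
    (f 0 ∙ ∑ n (λ i → f (suc i))) ∙ (g 0 ∙ ∑ n (λ i → g (suc i))) ∎

  ∑-zero : ∀ n (f : ℕ → A) → (∀ i → i < n → f i ≈ ε) → ∑ n f ≈ ε
  ∑-zero zero    f f≈ε = refl
  ∑-zero (suc n) f f≈ε = begin
    f 0 ∙ ∑ n (λ i → f (suc i)) ≈⟨ ∙-cong (f≈ε 0 (s≤s z≤n)) (∑-zero n _ (λ i i<n → f≈ε (suc i) (s≤s i<n))) ⟩
    ε ∙ ε                        ≈⟨ identityˡ ε ⟩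
    ε                            ∎

  ∑-split : ∀ a b (f : ℕ → A) → ∑ (a + b) f ≈ ∑ a f ∙ ∑ b (λ i → f (a + i))
  ∑-split zero    b f = sym (identityˡ _)
  ∑-split (suc a) b f = trans (∙-congˡ (∑-split a b (λ i → f (suc i)))) (sym (assoc _ _ _))

  ∑-restrict : ∀ m n (f : ℕ → A) → m ≤ n → (∀ i → m ≤ i → i < n → f i ≈ ε) → ∑ n f ≈ ∑ m f
  ∑-restrict m n f m≤n vanish = begin
    ∑ n f                                  ≡⟨ cong (λ k → ∑ k f) (m+[n∸m]≡n m≤n) ⟨
    ∑ (m + (n ∸ m)) f                      ≈⟨ ∑-split m (n ∸ m) f ⟩
    ∑ m f ∙ ∑ (n ∸ m) (λ i → f (m + i))    ≈⟨ ∙-congˡ (∑-zero (n ∸ m) _ tail≈ε) ⟩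
    ∑ m f ∙ ε                              ≈⟨ identityʳ _ ⟩
    ∑ m f                                  ∎
    where
    tail≈ε : ∀ i → i < n ∸ m → f (m + i) ≈ ε
    tail≈ε i i<n∸m = vanish (m + i) (m≤m+n m i) (subst (m + i <_) (m+[n∸m]≡n m≤n) (+-monoʳ-< m i<n∸m))

  ∑-single : ∀ n (f : ℕ → A) k → k < n → (∀ i → i < n → i ≢ k → f i ≈ ε) → ∑ n f ≈ f k
  ∑-single (suc n) f zero    _ others = begin
    f 0 ∙ ∑ n (λ i → f (suc i)) ≈⟨ ∙-congˡ (∑-zero n _ (λ i i<n → others (suc i) (s≤s i<n) (λ ()))) ⟩
    f 0 ∙ ε                     ≈⟨ identityʳ _ ⟩
    f 0                         ∎
  ∑-single (suc n) f (suc k) (s≤s k<n) others = begin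
    f 0 ∙ ∑ n (λ i → f (suc i)) ≈⟨ ∙-cong (others 0 (s≤s z≤n) (λ ())) (∑-single n _ k k<n others′) ⟩
    ε ∙ f (suc k)               ≈⟨ identityˡ _ ⟩
    f (suc k)                   ∎
    where
    others′ : ∀ i → i < n → i ≢ k → f (suc i) ≈ ε
    others′ i i<n i≢k = others (suc i) (s≤s i<n) (λ e → i≢k (suc-injective e))

  ∑-swap : ∀ m n (f : ℕ → ℕ → A) → ∑ m (λ i → ∑ n (f i)) ≈ ∑ n (λ k → ∑ m (λ i → f i k))
  ∑-swap zero    n f = sym (∑-zero n _ (λ _ _ → refl))
  ∑-swap (suc m) n f = trans (∙-congˡ (∑-swap m n (λ i → f (suc i)))) (sym (∑-distrib n _ _))

  ∑-blocks : ∀ N p (f : ℕ → A) → ∑ (N * p) f ≈ ∑ N (λ k → ∑ p (λ r → f (k * p + r)))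
  ∑-blocks zero    p f = refl
  ∑-blocks (suc N) p f = trans (∑-split p (N * p) f) (∙-congˡ (trans (∑-blocks N p _) inner))
    where
    inner : ∑ N (λ k → ∑ p (λ r → f (p + (k * p + r)))) ≈ ∑ N (λ k → ∑ p (λ r → f (p + k * p + r)))
    inner = ∑-cong N (λ k _ → ∑-cong p (λ r _ → reflexive (cong f (≡.sym (+-assoc p (k * p) r)))))

module PrimePowers where

  open import Data.List using ([]; _∷_)
  open import Data.List.Relation.Unary.All using (_∷_)
  open import Data.Nat
  open import Data.Nat.Properties
  open import Data.Nat.Divisibility
  open import Data.Nat.Coprimality using (Coprime; coprime-divisor)
  open import Data.Nat.Induction using (<-rec)
  open import Data.Nat.ListAction using (product)
  open import Data.Nat.Primality using (Prime; euclidsLemma; prime⇒irreducible; prime⇒nonZero; prime⇒nonTrivial; ¬prime[1])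
  open import Data.Nat.Primality.Factorisation using (factorise)
  open import Data.Product using (Σ-syntax; _×_; _,_)
  open import Data.Sum using (inj₁; inj₂)
  open import Relation.Nullary using (Dec; yes; no; ¬_; contradiction)
  open import Relation.Binary.PropositionalEquality
  open ≡-Reasoning

  prime⇒>1 : ∀ {p} → Prime p → p > 1
  prime⇒>1 {p} pp = nonTrivial⇒n>1 p {{prime⇒nonTrivial pp}}

  ¬∣⇒coprime : ∀ {p d} → Prime p → ¬ (p ∣ d) → Coprime d p
  ¬∣⇒coprime pp p∤d (i∣d , i∣p) with prime⇒irreducible pp i∣p
  ... | inj₁ i≡1 = i≡1
  ... | inj₂ refl = contradiction i∣d p∤d

  proper-divisor-of-prime-power : ∀ {p} e {d} → Prime p → d ∣ p ^ suc e → d ≢ p ^ suc e → d ∣ p ^ e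
  proper-divisor-of-prime-power {p} zero {d} pp d∣p d≢p with prime⇒irreducible pp (subst (d ∣_) (*-identityʳ p) d∣p)
  ... | inj₁ refl = ∣-refl
  ... | inj₂ refl = contradiction (sym (*-identityʳ p)) d≢p
  proper-divisor-of-prime-power {p} (suc e) {d} pp d∣p^[2+e] d≢p^[2+e] with p ∣? d
  ... | no  p∤d = coprime-divisor (¬∣⇒coprime pp p∤d) d∣p^[2+e]
  ... | yes (divides d′ refl) = subst (_∣ p * p ^ e) (*-comm p d′) (*-monoʳ-∣ p d′∣p^e)
    where
    instance _ = prime⇒nonZero pp
    d′∣p^e : d′ ∣ p ^ e
    d′∣p^e = proper-divisor-of-prime-power e pp (*-cancelˡ-∣ p (subst (_∣ p * p ^ suc e) (*-comm d′ p) d∣p^[2+e]))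
               (λ d′≡ → d≢p^[2+e] (trans (*-comm d′ p) (cong (p *_) d′≡)))

  coprime-divisor-^ : ∀ {d p} e {x} → Coprime d p → d ∣ p ^ e * x → d ∣ x
  coprime-divisor-^ {d} zero    {x} _     d∣x    = subst (d ∣_) (+-identityʳ x) d∣x
  coprime-divisor-^ {d} {p} (suc e) {x} d⊥p d∣p^[1+e]*x =
    coprime-divisor-^ e d⊥p (coprime-divisor d⊥p (subst (d ∣_) (*-assoc p (p ^ e) x) d∣p^[1+e]*x))

  prime-factor : ∀ n → n > 1 → Σ[ p ∈ ℕ ] Prime p × p ∣ n
  prime-factor n@(suc _) n>1 with factorise n
  ... | record { factors = [] ; isFactorisation = n≡1 } = contradiction n≡1 (>⇒≢ n>1)
  ... | record { factors = p ∷ ps ; isFactorisation = n≡p*Πps ; factorsPrime = pp ∷ _ } =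
    p , pp , divides (product ps) (trans n≡p*Πps (*-comm p (product ps)))

  prime-∣-^ : ∀ {q p} e → Prime q → q ∣ p ^ e → q ∣ p
  prime-∣-^ zero    qp q∣1 = contradiction (subst Prime (∣1⇒≡1 q∣1) qp) ¬prime[1]
  prime-∣-^ {p = p} (suc e) qp q∣p^[1+e] with euclidsLemma p (p ^ e) qp q∣p^[1+e]
  ... | inj₁ q∣p   = q∣p
  ... | inj₂ q∣p^e = prime-∣-^ e qp q∣p^e

  PAdic : ℕ → ℕ → Set
  PAdic p n = Σ[ e ∈ ℕ ] Σ[ m ∈ ℕ ] ¬ (p ∣ m) × p ^ suc e * m ≡ n

  p-adic : ∀ {p} → Prime p → ∀ n → .{{NonZero n}} → p ∣ n → PAdic p n
  p-adic {p} pp = <-rec (λ n → .{{NonZero n}} → p ∣ n → PAdic p n) go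
    where
    instance _ = prime⇒nonZero pp
    go : ∀ n → (∀ {c} → c < n → .{{NonZero c}} → p ∣ c → PAdic p c) → .{{NonZero n}} → p ∣ n → PAdic p n
    go n rec (divides c n≡c*p) = split (p ∣? c)
      where
      instance
        c≢0 : NonZero c
        c≢0 = ≢-nonZero λ { refl → ≢-nonZero⁻¹ n n≡c*p }
      split : Dec (p ∣ c) → PAdic p n
      split (no p∤c)  = 0 , c , p∤c , trans (cong (_* c) (*-identityʳ p)) (trans (*-comm p c) (sym n≡c*p))
      split (yes p∣c) with e , m , p∤m , p^[1+e]*m≡c ← rec (subst (c <_) (sym n≡c*p) (m<m*n c p (prime⇒>1 pp))) p∣c =
        suc e , m , p∤m , (begin
          p * p ^ suc e * m   ≡⟨ *-assoc p (p ^ suc e) m ⟩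
          p * (p ^ suc e * m) ≡⟨ cong (p *_) p^[1+e]*m≡c ⟩
          p * c               ≡⟨ *-comm p c ⟩
          c * p               ≡⟨ n≡c*p ⟨
          n                   ∎)

  PrimePowerPartsDivide : ℕ → ℕ → Set
  PrimePowerPartsDivide n y = ∀ {p m} e → Prime p → ¬ (p ∣ m) → p ^ suc e * m ≡ n → p ^ suc e ∣ y

  cofactor-parts : ∀ {p m y} e → Prime p → ¬ (p ∣ m) →
                   PrimePowerPartsDivide (p ^ suc e * m) y → PrimePowerPartsDivide m y
  cofactor-parts {p} {m} e pp p∤m parts {q} {m′} f qp q∤m′ Q*m′≡m = parts f qp q∤m′*P Q*[m′*P]≡P*m
    where
    P = p ^ suc e
    q∤m′*P : ¬ (q ∣ m′ * P)
    q∤m′*P q∣m′*P with euclidsLemma m′ P qp q∣m′*P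
    ... | inj₁ q∣m′ = q∤m′ q∣m′
    ... | inj₂ q∣P with prime⇒irreducible pp (prime-∣-^ (suc e) qp q∣P)
    ...   | inj₁ refl = ¬prime[1] qp
    ...   | inj₂ refl = p∤m (divides (q ^ f * m′) (trans (sym Q*m′≡m) (trans (*-assoc q (q ^ f) m′) (*-comm q _))))
    Q*[m′*P]≡P*m : q ^ suc f * (m′ * P) ≡ P * m
    Q*[m′*P]≡P*m = begin
      q ^ suc f * (m′ * P) ≡⟨ *-assoc (q ^ suc f) m′ P ⟨
      q ^ suc f * m′ * P   ≡⟨ cong (_* P) Q*m′≡m ⟩
      m * P                ≡⟨ *-comm m P ⟩
      P * m                ∎

  prime-power-parts⇒∣ : ∀ n {y} → .{{NonZero n}} → PrimePowerPartsDivide n y → n ∣ y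
  prime-power-parts⇒∣ = <-rec (λ n → ∀ {y} → .{{NonZero n}} → PrimePowerPartsDivide n y → n ∣ y) go
    where
    go : ∀ n → (∀ {m} → m < n → ∀ {y} → .{{NonZero m}} → PrimePowerPartsDivide m y → m ∣ y) →
         ∀ {y} → .{{NonZero n}} → PrimePowerPartsDivide n y → n ∣ y
    go 1               _   _     = 1∣ _
    go n@(suc (suc _)) rec {y} parts
      with p , pp , p∣n ← prime-factor n (s≤s (s≤s z≤n))
      with e , m , p∤m , P*m≡n ← p-adic pp n p∣n =
      subst (_∣ y) P*m≡n (subst (P * m ∣_) (sym y≡P*c) (*-monoʳ-∣ P m∣c))
      where
      P = p ^ suc e
      instance
        _ = prime⇒nonZero pp
        P≢0 : NonZero P
        P≢0 = m^n≢0 p (suc e)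
        m≢0 : NonZero m
        m≢0 = ≢-nonZero λ { refl → ≢-nonZero⁻¹ n (trans (sym P*m≡n) (*-zeroʳ P)) }
      P∣y : P ∣ y
      P∣y = parts e pp p∤m P*m≡n
      c = quotient P∣y
      y≡P*c : y ≡ P * c
      y≡P*c = m∣n⇒n≡m*quotient P∣y
      m<n : m < n
      m<n = subst (m <_) (trans (*-comm m P) P*m≡n) (m<m*n m P (<-≤-trans (prime⇒>1 pp) (m≤m*n p (p ^ e) {{m^n≢0 p e}})))
      m∣y : m ∣ y
      m∣y = rec m<n (cofactor-parts e pp p∤m (subst (λ k → PrimePowerPartsDivide k y) (sym P*m≡n) parts))
      m∣c : m ∣ c
      m∣c = coprime-divisor-^ (suc e) (¬∣⇒coprime pp p∤m) (subst (m ∣_) y≡P*c m∣y)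

module NatSums where

  open import Data.Bool using (if_then_else_)
  open import Data.Nat
  open import Data.Nat.Properties
  open import Relation.Nullary using (Dec; does; yes; no; ¬_; ¬?; contradiction)
  open import Relation.Binary.PropositionalEquality
  open ≡-Reasoning
  open RangeSum +-0-commutativeMonoid public

  𝟙 : ∀ {ℓ} {P : Set ℓ} → Dec P → ℕ
  𝟙 d = if does d then 1 else 0

  𝟙-yes : ∀ {ℓ} {P : Set ℓ} (d : Dec P) → P → 𝟙 d ≡ 1
  𝟙-yes (yes _) _ = refl
  𝟙-yes (no ¬p) p = contradiction p ¬p

  𝟙-no : ∀ {ℓ} {P : Set ℓ} (d : Dec P) → ¬ P → 𝟙 d ≡ 0
  𝟙-no (yes p) ¬p = contradiction p ¬p
  𝟙-no (no _)  _  = refl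

  𝟙-⇔ : ∀ {a b} {A : Set a} {B : Set b} (d : Dec A) (e : Dec B) → (A → B) → (B → A) → 𝟙 d ≡ 𝟙 e
  𝟙-⇔ (yes a) e       to from = sym (𝟙-yes e (to a))
  𝟙-⇔ (no ¬a) (yes b) to from = contradiction (from b) ¬a
  𝟙-⇔ (no _)  (no _)  to from = refl

  𝟙-¬? : ∀ {ℓ} {P : Set ℓ} (d : Dec P) → 𝟙 d + 𝟙 (¬? d) ≡ 1
  𝟙-¬? (yes _) = refl
  𝟙-¬? (no  _) = refl

  ∑-*ˡ : ∀ n c (f : ℕ → ℕ) → ∑ n (λ i → c * f i) ≡ c * ∑ n f
  ∑-*ˡ zero    c f = sym (*-zeroʳ c)
  ∑-*ˡ (suc n) c f = trans (cong (c * f 0 +_) (∑-*ˡ n c _)) (sym (*-distribˡ-+ c (f 0) _))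

  ∑-const : ∀ n c → ∑ n (λ _ → c) ≡ n * c
  ∑-const zero    c = refl
  ∑-const (suc n) c = cong (c +_) (∑-const n c)

  ∑-geometric : ∀ m → ∑ m (λ i → 2 ^ (m ∸ suc i)) + 1 ≡ 2 ^ m
  ∑-geometric zero    = refl
  ∑-geometric (suc m) = begin
    2 ^ m + ∑ m (λ i → 2 ^ (m ∸ suc i)) + 1   ≡⟨ +-assoc (2 ^ m) _ 1 ⟩
    2 ^ m + (∑ m (λ i → 2 ^ (m ∸ suc i)) + 1) ≡⟨ cong (2 ^ m +_) (∑-geometric m) ⟩
    2 ^ m + 2 ^ m                              ≡⟨ cong (2 ^ m +_) (+-identityʳ (2 ^ m)) ⟨
    2 ^ suc m                                  ∎

module BinaryWords where

  import Data.Bool.Properties as Bool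
  open import Data.Bool using (Bool; true; false)
  open import Data.List using (List; []; _∷_; _++_; length; [_])
  open import Data.List.Properties using (++-assoc; ++-identityʳ; length-++; ∷-injective; ∷ʳ-injective; ≡-dec)
  open import Data.Nat
  open import Data.Nat.Properties
  open import Algebra.Properties.CommutativeSemigroup +-commutativeSemigroup using (interchange)
  open import Data.Nat.Divisibility using (_∣_; quotient; ∣⇒≤; *-monoʳ-∣)
  open import Data.Nat.GCD using (gcd; gcd-GCD; gcd[m,n]∣m; gcd[m,n]∣n; c*gcd[m,n]≡gcd[cm,cn]; module Bézout)
  open import Data.Nat.Primality using (Prime)
  open import Data.Product using (Σ-syntax; _×_; _,_)
  open import Relation.Nullary using (Dec)
  open import Relation.Binary.PropositionalEquality hiding ([_])
  open ≡-Reasoning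
  open NatSums
  open PrimePowers using (proper-divisor-of-prime-power)

  Word : Set
  Word = List Bool

  infix 4 _≟ᵂ_
  _≟ᵂ_ : (v w : Word) → Dec (v ≡ w)
  _≟ᵂ_ = ≡-dec Bool._≟_

  ∑ᵂ : ℕ → (Word → ℕ) → ℕ
  ∑ᵂ zero    g = g []
  ∑ᵂ (suc n) g = ∑ᵂ n (λ w → g (false ∷ w)) + ∑ᵂ n (λ w → g (true ∷ w))

  ∑ᵂ-cong : ∀ n {f g : Word → ℕ} → (∀ w → length w ≡ n → f w ≡ g w) → ∑ᵂ n f ≡ ∑ᵂ n g
  ∑ᵂ-cong zero    f≡g = f≡g [] refl
  ∑ᵂ-cong (suc n) f≡g = cong₂ _+_ (∑ᵂ-cong n (λ w ∣w∣ → f≡g (false ∷ w) (cong suc ∣w∣)))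
                                  (∑ᵂ-cong n (λ w ∣w∣ → f≡g (true ∷ w) (cong suc ∣w∣)))

  ∑ᵂ-distrib : ∀ n (f g : Word → ℕ) → ∑ᵂ n (λ w → f w + g w) ≡ ∑ᵂ n f + ∑ᵂ n g
  ∑ᵂ-distrib zero    f g = refl
  ∑ᵂ-distrib (suc n) f g =
    trans (cong₂ _+_ (∑ᵂ-distrib n _ _) (∑ᵂ-distrib n _ _))
          (interchange (∑ᵂ n (λ w → f (false ∷ w))) (∑ᵂ n (λ w → g (false ∷ w)))
                       (∑ᵂ n (λ w → f (true ∷ w))) (∑ᵂ n (λ w → g (true ∷ w))))

  ∑ᵂ-const : ∀ n c → ∑ᵂ n (λ _ → c) ≡ 2 ^ n * c
  ∑ᵂ-const zero    c = sym (+-identityʳ c)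
  ∑ᵂ-const (suc n) c = begin
    ∑ᵂ n (λ _ → c) + ∑ᵂ n (λ _ → c) ≡⟨ cong₂ _+_ (∑ᵂ-const n c) (∑ᵂ-const n c) ⟩
    2 ^ n * c + 2 ^ n * c           ≡⟨ *-distribʳ-+ c (2 ^ n) _ ⟨
    (2 ^ n + 2 ^ n) * c             ≡⟨ cong (λ x → (2 ^ n + x) * c) (+-identityʳ (2 ^ n)) ⟨
    2 ^ suc n * c                   ∎

  ∑ᵂ-zero : ∀ n → ∑ᵂ n (λ _ → 0) ≡ 0
  ∑ᵂ-zero n = trans (∑ᵂ-const n 0) (*-zeroʳ (2 ^ n))

  ∑ᵂ-∑ : ∀ n m (f : Word → ℕ → ℕ) → ∑ᵂ n (λ w → ∑ m (f w)) ≡ ∑ m (λ k → ∑ᵂ n (λ w → f w k))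
  ∑ᵂ-∑ zero    m f = refl
  ∑ᵂ-∑ (suc n) m f = trans (cong₂ _+_ (∑ᵂ-∑ n m _) (∑ᵂ-∑ n m _)) (sym (∑-distrib m _ _))

  ∑ᵂ-∷ʳ : ∀ n (g : Word → ℕ) → ∑ᵂ (suc n) g ≡ ∑ᵂ n (λ w → g (w ++ [ false ])) + ∑ᵂ n (λ w → g (w ++ [ true ]))
  ∑ᵂ-∷ʳ zero    g = refl
  ∑ᵂ-∷ʳ (suc n) g = begin
    ∑ᵂ (suc n) (λ w → g (false ∷ w)) + ∑ᵂ (suc n) (λ w → g (true ∷ w))
      ≡⟨ cong₂ _+_ (∑ᵂ-∷ʳ n (λ w → g (false ∷ w))) (∑ᵂ-∷ʳ n (λ w → g (true ∷ w))) ⟩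
    (g₀₀ + g₀₁) + (g₁₀ + g₁₁) ≡⟨ interchange g₀₀ g₀₁ g₁₀ g₁₁ ⟩
    (g₀₀ + g₁₀) + (g₀₁ + g₁₁) ∎
    where
    g₀₀ = ∑ᵂ n (λ w → g (false ∷ w ++ [ false ]))
    g₀₁ = ∑ᵂ n (λ w → g (false ∷ w ++ [ true ]))
    g₁₀ = ∑ᵂ n (λ w → g (true ∷ w ++ [ false ]))
    g₁₁ = ∑ᵂ n (λ w → g (true ∷ w ++ [ true ]))

  ∑ᵂ-++ : ∀ m n (g : Word → ℕ) → ∑ᵂ (m + n) g ≡ ∑ᵂ m (λ u → ∑ᵂ n (λ v → g (u ++ v)))
  ∑ᵂ-++ zero    n g = refl
  ∑ᵂ-++ (suc m) n g = cong₂ _+_ (∑ᵂ-++ m n _) (∑ᵂ-++ m n _)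

  ∑ᵂ-delta : ∀ n (h : Word → ℕ) y → length y ≡ n → ∑ᵂ n (λ v → h v * 𝟙 (v ≟ᵂ y)) ≡ h y
  ∑ᵂ-delta zero    h []          _    = *-identityʳ (h [])
  ∑ᵂ-delta (suc n) h (false ∷ y) ∣y∣ = begin
    ∑ᵂ n (λ v → h (false ∷ v) * 𝟙 (v ≟ᵂ y)) + ∑ᵂ n (λ v → h (true ∷ v) * 0)
      ≡⟨ cong₂ _+_ (∑ᵂ-delta n (λ v → h (false ∷ v)) y (suc-injective ∣y∣)) (∑ᵂ-cong n (λ v _ → *-zeroʳ (h (true ∷ v)))) ⟩
    h (false ∷ y) + ∑ᵂ n (λ _ → 0)
      ≡⟨ cong (h (false ∷ y) +_) (∑ᵂ-zero n) ⟩
    h (false ∷ y) + 0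
      ≡⟨ +-identityʳ _ ⟩
    h (false ∷ y) ∎
  ∑ᵂ-delta (suc n) h (true ∷ y)  ∣y∣ = begin
    ∑ᵂ n (λ v → h (false ∷ v) * 0) + ∑ᵂ n (λ v → h (true ∷ v) * 𝟙 (v ≟ᵂ y))
      ≡⟨ cong₂ _+_ (∑ᵂ-cong n (λ v _ → *-zeroʳ (h (false ∷ v)))) (∑ᵂ-delta n (λ v → h (true ∷ v)) y (suc-injective ∣y∣)) ⟩
    ∑ᵂ n (λ _ → 0) + h (true ∷ y)
      ≡⟨ cong (_+ h (true ∷ y)) (∑ᵂ-zero n) ⟩
    h (true ∷ y) ∎

  rot : Word → Word
  rot []      = []
  rot (b ∷ w) = w ++ [ b ]

  rotate : ℕ → Word → Word
  rotate zero    w = w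
  rotate (suc k) w = rotate k (rot w)

  ∑ᵂ-rot : ∀ n (g : Word → ℕ) → ∑ᵂ n (λ w → g (rot w)) ≡ ∑ᵂ n g
  ∑ᵂ-rot zero    g = refl
  ∑ᵂ-rot (suc n) g = sym (∑ᵂ-∷ʳ n g)

  ∑ᵂ-rotate : ∀ k n (g : Word → ℕ) → ∑ᵂ n (λ w → g (rotate k w)) ≡ ∑ᵂ n g
  ∑ᵂ-rotate zero    n g = refl
  ∑ᵂ-rotate (suc k) n g = trans (∑ᵂ-rot n (λ w → g (rotate k w))) (∑ᵂ-rotate k n g)

  length-rot : ∀ w → length (rot w) ≡ length w
  length-rot []      = refl
  length-rot (b ∷ w) = trans (length-++ w) (+-comm (length w) 1)

  length-rotate : ∀ k w → length (rotate k w) ≡ length w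
  length-rotate zero    w = refl
  length-rotate (suc k) w = trans (length-rotate k (rot w)) (length-rot w)

  rotate-+ : ∀ a b w → rotate (a + b) w ≡ rotate b (rotate a w)
  rotate-+ zero    b w = refl
  rotate-+ (suc a) b w = rotate-+ a b (rot w)

  rotate-comm : ∀ a b w → rotate a (rotate b w) ≡ rotate b (rotate a w)
  rotate-comm a b w = trans (sym (rotate-+ b a w)) (trans (cong (λ k → rotate k w) (+-comm b a)) (rotate-+ a b w))

  rotate-++ : ∀ u v → rotate (length u) (u ++ v) ≡ v ++ u
  rotate-++ []      v = sym (++-identityʳ v)
  rotate-++ (b ∷ u) v = begin
    rotate (length u) ((u ++ v) ++ [ b ]) ≡⟨ cong (rotate (length u)) (++-assoc u v [ b ]) ⟩
    rotate (length u) (u ++ (v ++ [ b ])) ≡⟨ rotate-++ u (v ++ [ b ]) ⟩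
    (v ++ [ b ]) ++ u                     ≡⟨ ++-assoc v [ b ] u ⟩
    v ++ b ∷ u                            ∎

  rotate-length : ∀ w → rotate (length w) w ≡ w
  rotate-length w = begin
    rotate (length w) w        ≡⟨ cong (rotate (length w)) (++-identityʳ w) ⟨
    rotate (length w) (w ++ []) ≡⟨ rotate-++ w [] ⟩
    w                          ∎

  rotate-periodic : ∀ a c w → rotate a w ≡ w → rotate (c * a) w ≡ w
  rotate-periodic a zero    w _  = refl
  rotate-periodic a (suc c) w aw = begin
    rotate (a + c * a) w        ≡⟨ rotate-+ a (c * a) w ⟩
    rotate (c * a) (rotate a w) ≡⟨ cong (rotate (c * a)) aw ⟩
    rotate (c * a) w            ≡⟨ rotate-periodic a c w aw ⟩
    w                           ∎

  rotate-gcd : ∀ a b w → rotate a w ≡ w → rotate b w ≡ w → rotate (gcd a b) w ≡ w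
  rotate-gcd a b w aw bw with Bézout.identity (gcd-GCD a b)
  ... | Bézout.+- x y eq = begin
    rotate (gcd a b) w                 ≡⟨ cong (rotate (gcd a b)) (rotate-periodic b y w bw) ⟨
    rotate (gcd a b) (rotate (y * b) w) ≡⟨ rotate-+ (y * b) (gcd a b) w ⟨
    rotate (y * b + gcd a b) w         ≡⟨ cong (λ i → rotate i w) (trans (+-comm (y * b) _) eq) ⟩
    rotate (x * a) w                   ≡⟨ rotate-periodic a x w aw ⟩
    w                                  ∎
  ... | Bézout.-+ x y eq = begin
    rotate (gcd a b) w                 ≡⟨ cong (rotate (gcd a b)) (rotate-periodic a x w aw) ⟨
    rotate (gcd a b) (rotate (x * a) w) ≡⟨ rotate-+ (x * a) (gcd a b) w ⟨
    rotate (x * a + gcd a b) w         ≡⟨ cong (λ i → rotate i w) (trans (+-comm (x * a) _) eq) ⟩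
    rotate (y * b) w                   ≡⟨ rotate-periodic b y w bw ⟩
    w                                  ∎

  rotate-prime-power-period : ∀ {p} e r {k w} → Prime p → length w ≡ r * p ^ suc e → 0 < k → k < p ^ suc e →
                              rotate (r * k) w ≡ w → rotate (r * p ^ e) w ≡ w
  rotate-prime-power-period {p} e r {k} {w} pp ∣w∣ 0<k k<q rkw =
    trans (cong (λ i → rotate i w) (_∣_.equality gcd∣r*p^e))
          (rotate-periodic _ (quotient gcd∣r*p^e) w (rotate-gcd (r * k) (r * q) w rkw full-turn))
    where
    q = p ^ suc e
    instance _ = >-nonZero 0<k
    g≢q : gcd k q ≢ q
    g≢q g≡q = <⇒≱ k<q (subst (_≤ k) g≡q (∣⇒≤ (gcd[m,n]∣m k q)))
    gcd∣r*p^e : gcd (r * k) (r * q) ∣ r * p ^ e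
    gcd∣r*p^e = subst (_∣ r * p ^ e) (c*gcd[m,n]≡gcd[cm,cn] r k q)
                      (*-monoʳ-∣ r (proper-divisor-of-prime-power e pp (gcd[m,n]∣n k q) g≢q))
    full-turn : rotate (r * q) w ≡ w
    full-turn = trans (cong (λ i → rotate i w) (sym ∣w∣)) (rotate-length w)

  rot-injective : ∀ {v w} → rot v ≡ rot w → v ≡ w
  rot-injective {[]}        {[]}        _  = refl
  rot-injective {[]}        {_ ∷ []}    ()
  rot-injective {[]}        {_ ∷ _ ∷ _} ()
  rot-injective {_ ∷ []}    {[]}        ()
  rot-injective {_ ∷ _ ∷ _} {[]}        ()
  rot-injective {a ∷ v}     {b ∷ w}     eq with ∷ʳ-injective v w eq
  ... | refl , refl = refl

  rotate-injective : ∀ k {v w} → rotate k v ≡ rotate k w → v ≡ w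
  rotate-injective zero    eq = eq
  rotate-injective (suc k) eq = rot-injective (rotate-injective k eq)

  repeat : ℕ → Word → Word
  repeat zero    u = []
  repeat (suc p) u = u ++ repeat p u

  repeat-∷ʳ : ∀ p u → repeat (suc p) u ≡ repeat p u ++ u
  repeat-∷ʳ zero    u = ++-identityʳ u
  repeat-∷ʳ (suc p) u = trans (cong (u ++_) (repeat-∷ʳ p u)) (sym (++-assoc u (repeat p u) u))

  length-repeat : ∀ p u → length (repeat p u) ≡ p * length u
  length-repeat zero    u = refl
  length-repeat (suc p) u = trans (length-++ u) (cong (length u +_) (length-repeat p u))

  ++-injective : ∀ a {b c d : Word} → length a ≡ length c → a ++ b ≡ c ++ d → a ≡ c × b ≡ d
  ++-injective []      {c = []}    _    eq = refl , eq
  ++-injective (x ∷ a) {c = y ∷ c} ∣a∣≡∣c∣ eq with ∷-injective eq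
  ... | refl , eq′ with ++-injective a {c = c} (suc-injective ∣a∣≡∣c∣) eq′
  ...   | refl , b≡d = refl , b≡d

  split-at : ∀ ℓ (v : Word) → ℓ ≤ length v → Σ[ v₁ ∈ Word ] Σ[ v₂ ∈ Word ] v ≡ v₁ ++ v₂ × length v₁ ≡ ℓ
  split-at zero    v       _         = [] , v , refl , refl
  split-at (suc ℓ) (b ∷ v) (s≤s ℓ≤∣v∣) with split-at ℓ v ℓ≤∣v∣
  ... | v₁ , v₂ , refl , refl = b ∷ v₁ , v₂ , refl , refl

  commuting⇒repeat : ∀ p u v → length v ≡ p * length u → v ++ u ≡ u ++ v → v ≡ repeat p u
  commuting⇒repeat zero    u []      _     _    = refl
  commuting⇒repeat (suc p) u v       ∣v∣ comm
    with split-at (length u) v (subst (length u ≤_) (sym ∣v∣) (m≤m+n (length u) _))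
  ... | v₁ , v₂ , refl , ∣v₁∣ with ++-injective v₁ {c = u} ∣v₁∣ (trans (sym (++-assoc v₁ v₂ u)) comm)
  ...   | refl , comm₂ = cong (v₁ ++_) (commuting⇒repeat p v₁ v₂ ∣v₂∣ comm₂)
    where
    ∣v₂∣ : length v₂ ≡ p * length v₁
    ∣v₂∣ = +-cancelˡ-≡ (length v₁) _ _ (trans (sym (length-++ v₁)) ∣v∣)

module RotationOrbits (n r q : ℕ) .{{_ : NonZero q}} (r*q≡n : r ℕ.* q ≡ n) where

  import Data.Bool.Properties as Bool
  open import Data.List using (List; length; upTo)
  open import Data.Nat
  open import Data.List.Extrema using (argmin; argmin-all; f[argmin]≤f[xs])
  open import Data.List.Membership.Propositional.Properties using (∈-upTo⁺; ∈-upTo⁻)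
  import Data.List.Relation.Binary.Lex.NonStrict as Lex
  open import Data.List.Relation.Binary.Pointwise using (Pointwise-≡⇒≡)
  open import Data.List.Relation.Unary.All using (lookup; tabulate)
  open import Data.Nat.DivMod using (_%_; _/_; m≡m%n+[m/n]*n; m%n<n)
  open import Data.Nat.Divisibility using (_∣_; divides)
  open import Data.Nat.Properties
  open import Relation.Binary.Bundles using (DecTotalOrder)
  open import Relation.Binary.Definitions using (tri<; tri≈; tri>)
  open import Relation.Nullary using (Dec; yes; no; contradiction)
  open import Relation.Binary.PropositionalEquality
  open ≡-Reasoning
  open NatSums
  open BinaryWords

  open DecTotalOrder (Lex.≤-decTotalOrder Bool.≤-decTotalOrder)
    using (totalOrder) renaming (_≤_ to _≤ᴸ_; _≤?_ to _≤ᴸ?_; antisym to ≤ᴸ-antisym)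

  shift : ℕ → Word → Word
  shift k = rotate (r * k)

  shift-+ : ∀ a b w → shift (a + b) w ≡ shift b (shift a w)
  shift-+ a b w = trans (cong (λ i → rotate i w) (*-distribˡ-+ r a b)) (rotate-+ (r * a) (r * b) w)

  shift-multiple : ∀ c w → length w ≡ n → shift (c * q) w ≡ w
  shift-multiple c w ∣w∣≡n = begin
    rotate (r * (c * q)) w ≡⟨ cong (λ i → rotate i w) r*[c*q]≡c*∣w∣ ⟩
    rotate (c * length w) w ≡⟨ rotate-periodic (length w) c w (rotate-length w) ⟩
    w                       ∎
    where
    r*[c*q]≡c*∣w∣ : r * (c * q) ≡ c * length w
    r*[c*q]≡c*∣w∣ = trans (x∙yz≈y∙xz r c q) (cong (c *_) (trans r*q≡n (sym ∣w∣≡n)))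
      where open import Algebra.Properties.CommutativeSemigroup *-commutativeSemigroup using (x∙yz≈y∙xz)

  shift-period : ∀ w → length w ≡ n → shift q w ≡ w
  shift-period w ∣w∣≡n = trans (cong (λ i → shift i w) (sym (*-identityˡ q))) (shift-multiple 1 w ∣w∣≡n)

  shift-mod : ∀ t w → length w ≡ n → shift t w ≡ shift (t % q) w
  shift-mod t w ∣w∣≡n = begin
    shift t w                           ≡⟨ cong (λ i → shift i w) (trans (m≡m%n+[m/n]*n t q) (+-comm (t % q) _)) ⟩
    shift ((t / q) * q + t % q) w       ≡⟨ shift-+ ((t / q) * q) (t % q) w ⟩
    shift (t % q) (shift ((t / q) * q) w) ≡⟨ cong (shift (t % q)) (shift-multiple (t / q) w ∣w∣≡n) ⟩
    shift (t % q) w                     ∎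

  Minimal : Word → Set
  Minimal w = ∀ {k} → k < q → w ≤ᴸ shift k w

  minimal? : ∀ w → Dec (Minimal w)
  minimal? w = allUpTo? (λ k → w ≤ᴸ? shift k w) q

  Minimal⇒≤-shift : ∀ {w} → length w ≡ n → Minimal w → ∀ t → w ≤ᴸ shift t w
  Minimal⇒≤-shift {w} ∣w∣≡n min t = subst (w ≤ᴸ_) (sym (shift-mod t w ∣w∣≡n)) (min (m%n<n t q))

  FreeOrbit : Word → Set
  FreeOrbit w = ∀ {k} → 0 < k → k < q → shift k w ≢ w

  FreeOrbit⇒shift-injective : ∀ {w} → FreeOrbit w → ∀ {a b} → a < b → b < q → shift a w ≢ shift b w
  FreeOrbit⇒shift-injective {w} free {a} {b} a<b b<q eq = free (m<n⇒0<n∸m a<b) (≤-<-trans (m∸n≤m b a) b<q) (sym w≡shift)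
    where
    w≡shift : w ≡ shift (b ∸ a) w
    w≡shift = rotate-injective (r * a) (trans eq (begin
      shift b w                   ≡⟨ cong (λ i → shift i w) (m+[n∸m]≡n (<⇒≤ a<b)) ⟨
      shift (a + (b ∸ a)) w       ≡⟨ shift-+ a (b ∸ a) w ⟩
      shift (b ∸ a) (shift a w)   ≡⟨ rotate-comm (r * (b ∸ a)) (r * a) w ⟩
      shift a (shift (b ∸ a) w)   ∎))

  module _ {w} (∣w∣≡n : length w ≡ n) (free : FreeOrbit w) where

    private
      k₀ : ℕ
      k₀ = argmin totalOrder (λ k → shift k w) 0 (upTo q)

      k₀<q : k₀ < q
      k₀<q = argmin-all totalOrder (λ k → shift k w) {P = _< q} (>-nonZero⁻¹ q) (tabulate ∈-upTo⁻)

      k₀-least : ∀ {k} → k < q → shift k₀ w ≤ᴸ shift k w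
      k₀-least k<q = lookup (f[argmin]≤f[xs] totalOrder 0 (upTo q)) (∈-upTo⁺ k<q)

      shift-length : ∀ k → length (shift k w) ≡ n
      shift-length k = trans (length-rotate (r * k) w) ∣w∣≡n

      shift-k₀-minimal : Minimal (shift k₀ w)
      shift-k₀-minimal {i} i<q = subst (shift k₀ w ≤ᴸ_) eq (k₀-least (m%n<n (k₀ + i) q))
        where
        eq : shift ((k₀ + i) % q) w ≡ shift i (shift k₀ w)
        eq = trans (sym (shift-mod (k₀ + i) w ∣w∣≡n)) (shift-+ k₀ i w)

      minimal⇒shift-k₀ : ∀ {a} → a < q → Minimal (shift a w) → shift a w ≡ shift k₀ w
      minimal⇒shift-k₀ {a} a<q min = Pointwise-≡⇒≡ (≤ᴸ-antisym (subst (shift a w ≤ᴸ_) eq ≤shift) (k₀-least a<q))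
        where
        ≤shift : shift a w ≤ᴸ shift (q ∸ a + k₀) (shift a w)
        ≤shift = Minimal⇒≤-shift (shift-length a) min (q ∸ a + k₀)
        eq : shift (q ∸ a + k₀) (shift a w) ≡ shift k₀ w
        eq = begin
          shift (q ∸ a + k₀) (shift a w) ≡⟨ shift-+ a (q ∸ a + k₀) w ⟨
          shift (a + (q ∸ a + k₀)) w     ≡⟨ cong (λ i → shift i w) (trans (sym (+-assoc a (q ∸ a) k₀))
                                                                         (cong (_+ k₀) (m+[n∸m]≡n (<⇒≤ a<q)))) ⟩
          shift (q + k₀) w               ≡⟨ shift-+ q k₀ w ⟩
          shift k₀ (shift q w)           ≡⟨ cong (shift k₀) (shift-period w ∣w∣≡n) ⟩
          shift k₀ w                     ∎

      minimal⇒k₀ : ∀ {a} → a < q → Minimal (shift a w) → a ≡ k₀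
      minimal⇒k₀ {a} a<q min with <-cmp a k₀
      ... | tri≈ _ a≡k₀ _ = a≡k₀
      ... | tri< a<k₀ _ _ = contradiction (minimal⇒shift-k₀ a<q min) (FreeOrbit⇒shift-injective free a<k₀ k₀<q)
      ... | tri> _ _ k₀<a = contradiction (sym (minimal⇒shift-k₀ a<q min)) (FreeOrbit⇒shift-injective free k₀<a a<q)

    unique-minimal-shift : ∑ q (λ k → 𝟙 (minimal? (shift k w))) ≡ 1
    unique-minimal-shift = trans (∑-single q _ k₀ k₀<q others) (𝟙-yes (minimal? (shift k₀ w)) shift-k₀-minimal)
      where
      others : ∀ k → k < q → k ≢ k₀ → 𝟙 (minimal? (shift k w)) ≡ 0
      others k k<q k≢k₀ = 𝟙-no (minimal? (shift k w)) (λ min → k≢k₀ (minimal⇒k₀ k<q min))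

  -- Each free orbit contains exactly one lexicographically minimal word, so marking the minimal words
  -- regroups the sum into q equal parts.
  orbits-divide : (h : Word → ℕ) → (∀ k w → h (rotate k w) ≡ h w) →
                  (∀ w → length w ≡ n → h w ≢ 0 → FreeOrbit w) → q ∣ ∑ᵂ n h
  orbits-divide h h-invariant h-free = divides (∑ᵂ n (λ w → h w * e w)) (trans orbit-sum (*-comm q _))
    where
    e : Word → ℕ
    e w = 𝟙 (minimal? w)
    marked : ∀ w → length w ≡ n → h w ≡ h w * ∑ q (λ k → e (shift k w))
    marked w ∣w∣≡n with h w ≟ 0
    ... | yes hw≡0 = trans hw≡0 (sym (cong (_* ∑ q (λ k → e (shift k w))) hw≡0))
    ... | no  hw≢0 = sym (trans (cong (h w *_) (unique-minimal-shift ∣w∣≡n (h-free w ∣w∣≡n hw≢0))) (*-identityʳ (h w)))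
    orbit-sum : ∑ᵂ n h ≡ q * ∑ᵂ n (λ w → h w * e w)
    orbit-sum = begin
      ∑ᵂ n h
        ≡⟨ ∑ᵂ-cong n marked ⟩
      ∑ᵂ n (λ w → h w * ∑ q (λ k → e (shift k w)))
        ≡⟨ ∑ᵂ-cong n (λ w _ → ∑-*ˡ q (h w) _) ⟨
      ∑ᵂ n (λ w → ∑ q (λ k → h w * e (shift k w)))
        ≡⟨ ∑ᵂ-∑ n q _ ⟩
      ∑ q (λ k → ∑ᵂ n (λ w → h w * e (shift k w)))
        ≡⟨ ∑-cong q (λ k _ → ∑ᵂ-cong n (λ w _ → cong (_* e (shift k w)) (h-invariant (r * k) w))) ⟨
      ∑ q (λ k → ∑ᵂ n (λ w → h (shift k w) * e (shift k w)))
        ≡⟨ ∑-cong q (λ k _ → ∑ᵂ-rotate (r * k) n (λ w → h w * e w)) ⟩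
      ∑ q (λ _ → ∑ᵂ n (λ w → h w * e w))
        ≡⟨ ∑-const q _ ⟩
      q * ∑ᵂ n (λ w → h w * e w) ∎

module LucasAutomaton (j : ℕ) (0<j : 0 < j) where

  open import Data.Bool using (Bool; true; false)
  open import Data.List using (List; []; _∷_; _++_; length; [_])
  open import Data.List.Properties using (length-++)
  open import Data.Maybe using (Maybe; just; nothing)
  open import Data.Maybe.Properties using (just-injective)
  open import Data.Nat
  open import Data.Nat.Properties
  open import Data.Nat.Divisibility
  open import Data.Nat.Primality using (Prime; prime⇒nonZero)
  open import Data.Product using (Σ-syntax; _×_; _,_)
  open import Data.Sum using (_⊎_; inj₁; inj₂)
  open import Data.Unit using (⊤; tt)
  open import Relation.Nullary using (yes; no; ¬?; contradiction)
  open import Relation.Binary.PropositionalEquality hiding ([_])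
  open ≡-Reasoning
  open NatSums
  open BinaryWords

  -- States c < j count the `false`s read since the last `true`; `nothing` is the dead state reached after
  -- j of them. The transition matrix is the companion matrix of x^j − x^(j−1) − ⋯ − 1, and `lucas n`
  -- below is the trace of its n-th power.
  State : Set
  State = Maybe ℕ

  step : Bool → State → State
  step _     nothing  = nothing
  step true  (just c) = just 0
  step false (just c) with suc c <? j
  ... | yes _ = just (suc c)
  ... | no  _ = nothing

  run : State → Word → State
  run x []      = x
  run x (b ∷ w) = run (step b x) w

  hit : State → ℕ → ℕ
  hit nothing  d = 0
  hit (just c) d = 𝟙 (c ≟ d)

  Bounded : State → Set
  Bounded nothing  = ⊤
  Bounded (just c) = c < j

  run-++ : ∀ x u v → run x (u ++ v) ≡ run (run x u) v
  run-++ x []      v = refl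
  run-++ x (b ∷ u) v = run-++ (step b x) u v

  run-∷ʳ : ∀ x w b → run x (w ++ [ b ]) ≡ step b (run x w)
  run-∷ʳ x w b = run-++ x w [ b ]

  run-nothing : ∀ w → run nothing w ≡ nothing
  run-nothing []      = refl
  run-nothing (b ∷ w) = run-nothing w

  step-bounded : ∀ b x → Bounded (step b x)
  step-bounded b     nothing  = tt
  step-bounded true  (just c) = 0<j
  step-bounded false (just c) with suc c <? j
  ... | yes c+1<j = c+1<j
  ... | no  _     = tt

  run-bounded : ∀ x w → Bounded x → Bounded (run x w)
  run-bounded x []      bx = bx
  run-bounded x (b ∷ w) _  = run-bounded (step b x) w (step-bounded b x)

  hit-self : ∀ c → hit (just c) c ≡ 1
  hit-self c = 𝟙-yes (c ≟ c) refl

  hit-other : ∀ {c d} → c ≢ d → hit (just c) d ≡ 0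
  hit-other {c} {d} = 𝟙-no (c ≟ d)

  ∑-hit : ∀ {c} → c < j → ∑ j (hit (just c)) ≡ 1
  ∑-hit {c} c<j = trans (∑-single j (hit (just c)) c c<j (λ d _ d≢c → hit-other (λ c≡d → d≢c (sym c≡d))))
                        (hit-self c)

  -- The 0/1 matrix of a partial map G has entries hit (G (just d)) c; this is its product formula.
  hit-∘ : ∀ (G : State → State) → G nothing ≡ nothing → ∀ x → Bounded x → ∀ c →
          hit (G x) c ≡ ∑ j (λ d → hit x d * hit (G (just d)) c)
  hit-∘ G G-nothing nothing  _   c = trans (cong (λ y → hit y c) G-nothing) (sym (∑-zero j _ (λ _ _ → refl)))
  hit-∘ G G-nothing (just e) e<j c = sym (begin
    ∑ j (λ d → hit (just e) d * hit (G (just d)) c)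
      ≡⟨ ∑-single j _ e e<j (λ d _ d≢e → cong (_* hit (G (just d)) c) (hit-other (λ e≡d → d≢e (sym e≡d)))) ⟩
    hit (just e) e * hit (G (just e)) c ≡⟨ cong (_* hit (G (just e)) c) (hit-self e) ⟩
    1 * hit (G (just e)) c              ≡⟨ *-identityˡ _ ⟩
    hit (G (just e)) c                  ∎)

  trace-∘-comm : (F G : State → State) → F nothing ≡ nothing → G nothing ≡ nothing →
                 (∀ c → c < j → Bounded (F (just c))) → (∀ c → c < j → Bounded (G (just c))) →
                 ∑ j (λ c → hit (G (F (just c))) c) ≡ ∑ j (λ c → hit (F (G (just c))) c)
  trace-∘-comm F G F-nothing G-nothing F-bounded G-bounded = begin
    ∑ j (λ c → hit (G (F (just c))) c)
      ≡⟨ ∑-cong j (λ c c<j → hit-∘ G G-nothing (F (just c)) (F-bounded c c<j) c) ⟩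
    ∑ j (λ c → ∑ j (λ d → hit (F (just c)) d * hit (G (just d)) c))
      ≡⟨ ∑-swap j j _ ⟩
    ∑ j (λ d → ∑ j (λ c → hit (F (just c)) d * hit (G (just d)) c))
      ≡⟨ ∑-cong j (λ d _ → ∑-cong j (λ c _ → *-comm (hit (F (just c)) d) _)) ⟩
    ∑ j (λ d → ∑ j (λ c → hit (G (just d)) c * hit (F (just c)) d))
      ≡⟨ ∑-cong j (λ d d<j → sym (hit-∘ F F-nothing (G (just d)) (G-bounded d d<j) d)) ⟩
    ∑ j (λ d → hit (F (G (just d))) d) ∎

  walks : ℕ → ℕ → ℕ → ℕ
  walks n c d = ∑ᵂ n (λ w → hit (run (just c) w) d)

  walksFrom : ℕ → ℕ → ℕ
  walksFrom n c = ∑ j (walks n c)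

  resetWalks : ℕ → ℕ → ℕ
  resetWalks zero    c = 0
  resetWalks (suc n) c = walksFrom n c

  fixCount : Word → ℕ
  fixCount w = ∑ j (λ c → hit (run (just c) w) c)

  lucas : ℕ → ℕ
  lucas n = ∑ᵂ n fixCount

  step-true : ∀ x → Bounded x → hit (step true x) 0 ≡ ∑ j (hit x)
  step-true nothing  _   = sym (∑-zero j _ (λ _ _ → refl))
  step-true (just c) c<j = sym (∑-hit c<j)

  step-false : ∀ x d → suc d < j → hit (step false x) (suc d) ≡ hit x d
  step-false nothing  d _ = refl
  step-false (just c) d d+1<j with suc c <? j
  ... | yes _     = refl
  ... | no  c+1≮j = sym (hit-other {c} {d} (λ { refl → c+1≮j d+1<j }))

  walks-suc-zero : ∀ m c → c < j → walks (suc m) c 0 ≡ walksFrom m c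
  walks-suc-zero m c c<j = begin
    walks (suc m) c 0
      ≡⟨ ∑ᵂ-∷ʳ m (λ w → hit (run (just c) w) 0) ⟩
    ∑ᵂ m (λ w → hit (run (just c) (w ++ [ false ])) 0) + ∑ᵂ m (λ w → hit (run (just c) (w ++ [ true ])) 0)
      ≡⟨ cong₂ _+_ (∑ᵂ-cong m (λ w _ → trans (cong (λ x → hit x 0) (run-∷ʳ (just c) w false)) (dies (run (just c) w))))
                   (∑ᵂ-cong m (λ w _ → trans (cong (λ x → hit x 0) (run-∷ʳ (just c) w true))
                                             (step-true (run (just c) w) (run-bounded (just c) w c<j)))) ⟩
    ∑ᵂ m (λ _ → 0) + ∑ᵂ m (λ w → ∑ j (hit (run (just c) w)))
      ≡⟨ cong₂ _+_ (∑ᵂ-zero m) (∑ᵂ-∑ m j _) ⟩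
    walksFrom m c ∎
    where
    dies : ∀ x → hit (step false x) 0 ≡ 0
    dies nothing = refl
    dies (just c) with suc c <? j
    ... | yes _ = refl
    ... | no  _ = refl

  walks-suc-suc : ∀ m c d → suc d < j → walks (suc m) c (suc d) ≡ walks m c d
  walks-suc-suc m c d d+1<j = begin
    walks (suc m) c (suc d)
      ≡⟨ ∑ᵂ-∷ʳ m (λ w → hit (run (just c) w) (suc d)) ⟩
    ∑ᵂ m (λ w → hit (run (just c) (w ++ [ false ])) (suc d)) + ∑ᵂ m (λ w → hit (run (just c) (w ++ [ true ])) (suc d))
      ≡⟨ cong₂ _+_ (∑ᵂ-cong m (λ w _ → trans (cong (λ x → hit x (suc d)) (run-∷ʳ (just c) w false))
                                             (step-false (run (just c) w) d d+1<j)))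
                   (∑ᵂ-cong m (λ w _ → trans (cong (λ x → hit x (suc d)) (run-∷ʳ (just c) w true))
                                             (resets (run (just c) w)))) ⟩
    walks m c d + ∑ᵂ m (λ _ → 0) ≡⟨ cong (walks m c d +_) (∑ᵂ-zero m) ⟩
    walks m c d + 0              ≡⟨ +-identityʳ _ ⟩
    walks m c d                  ∎
    where
    resets : ∀ x → hit (step true x) (suc d) ≡ 0
    resets nothing  = refl
    resets (just _) = refl

  -- A walk of length k from c to d either passes through a reset, the last one k ∸ d steps in,
  -- or never resets, in which case d = c + k.
  walks-formula : ∀ k c d → c < j → d < j → walks k c d ≡ resetWalks (k ∸ d) c + 𝟙 (k + c ≟ d)
  walks-formula zero    c zero    _   _   = refl
  walks-formula zero    c (suc d) _   _   = refl
  walks-formula (suc k) c zero    c<j _   = trans (walks-suc-zero k c c<j) (sym (+-identityʳ _))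
  walks-formula (suc k) c (suc d) c<j d+1<j =
    trans (walks-suc-suc k c d d+1<j) (walks-formula k c d c<j (<-trans (n<1+n d) d+1<j))

  lucas-resetWalks : ∀ m → 1 ≤ m → lucas m ≡ ∑ j (λ c → resetWalks (m ∸ c) c)
  lucas-resetWalks m@(suc m′) _ = begin
    lucas m
      ≡⟨ ∑ᵂ-∑ m j (λ w c → hit (run (just c) w) c) ⟩
    ∑ j (λ c → walks m c c)
      ≡⟨ ∑-cong j (λ c c<j → walks-formula m c c c<j c<j) ⟩
    ∑ j (λ c → resetWalks (m ∸ c) c + 𝟙 (m + c ≟ c))
      ≡⟨ ∑-cong j (λ c _ → cong (resetWalks (m ∸ c) c +_) (no-loop c)) ⟩
    ∑ j (λ c → resetWalks (m ∸ c) c + 0)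
      ≡⟨ ∑-cong j (λ c _ → +-identityʳ _) ⟩
    ∑ j (λ c → resetWalks (m ∸ c) c) ∎
    where
    no-loop : ∀ c → 𝟙 (m + c ≟ c) ≡ 0
    no-loop c = 𝟙-no (m + c ≟ c) (λ m+c≡c → m≢1+n+m c (sym m+c≡c))

  lucas-rec : ∀ n → j ≤ n → lucas (suc n) ≡ ∑ j (λ i → lucas (n ∸ i))
  lucas-rec n j≤n = begin
    lucas (suc n)
      ≡⟨ lucas-resetWalks (suc n) (s≤s z≤n) ⟩
    ∑ j (λ c → resetWalks (suc n ∸ c) c)
      ≡⟨ ∑-cong j (λ c c<j → cong (λ k → resetWalks k c) (+-∸-assoc 1 (c≤n c<j))) ⟩
    ∑ j (λ c → walksFrom (n ∸ c) c)
      ≡⟨ ∑-cong j (λ c c<j → ∑-cong j (λ i i<j → long-walks c i c<j i<j)) ⟩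
    ∑ j (λ c → ∑ j (λ i → resetWalks (n ∸ c ∸ i) c))
      ≡⟨ ∑-swap j j _ ⟩
    ∑ j (λ i → ∑ j (λ c → resetWalks (n ∸ c ∸ i) c))
      ≡⟨ ∑-cong j (λ i _ → ∑-cong j (λ c _ → cong (λ k → resetWalks k c) (∸-comm c i))) ⟩
    ∑ j (λ i → ∑ j (λ c → resetWalks (n ∸ i ∸ c) c))
      ≡⟨ ∑-cong j (λ i i<j → lucas-resetWalks (n ∸ i) (m<n⇒0<n∸m (<-≤-trans i<j j≤n))) ⟨
    ∑ j (λ i → lucas (n ∸ i)) ∎
    where
    c≤n : ∀ {c} → c < j → c ≤ n
    c≤n c<j = ≤-trans (<⇒≤ c<j) j≤n
    ∸-comm : ∀ c i → n ∸ c ∸ i ≡ n ∸ i ∸ c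
    ∸-comm c i = trans (∸-+-assoc n c i) (trans (cong (n ∸_) (+-comm c i)) (sym (∸-+-assoc n i c)))
    long-walks : ∀ c i → c < j → i < j → walks (n ∸ c) c i ≡ resetWalks (n ∸ c ∸ i) c
    long-walks c i c<j i<j = begin
      walks (n ∸ c) c i
        ≡⟨ walks-formula (n ∸ c) c i c<j i<j ⟩
      resetWalks (n ∸ c ∸ i) c + 𝟙 (n ∸ c + c ≟ i)
        ≡⟨ cong (resetWalks (n ∸ c ∸ i) c +_) (𝟙-no (n ∸ c + c ≟ i) too-long) ⟩
      resetWalks (n ∸ c ∸ i) c + 0
        ≡⟨ +-identityʳ _ ⟩
      resetWalks (n ∸ c ∸ i) c ∎
      where
      too-long : n ∸ c + c ≢ i
      too-long eq = <⇒≱ i<j (subst (j ≤_) (trans (sym (m∸n+n≡m (c≤n c<j))) eq) j≤n)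

  alive : ∀ c w → c + length w < j → ∑ j (hit (run (just c) w)) ≡ 1
  alive c []          c+0<j = ∑-hit (subst (_< j) (+-identityʳ c) c+0<j)
  alive c (true ∷ w)  c+∣w∣<j = alive 0 w (<-≤-trans (n<1+n (length w)) (≤-trans (m≤n+m _ c) (<⇒≤ c+∣w∣<j)))
  alive c (false ∷ w) c+∣w∣<j with suc c <? j
  ... | yes _     = alive (suc c) w (subst (_< j) (+-suc c _) c+∣w∣<j)
  ... | no  c+1≮j = contradiction (≤-<-trans (s≤s (m≤m+n c _)) (subst (_< j) (+-suc c _) c+∣w∣<j)) c+1≮j

  walksFrom-short : ∀ k c → c + k < j → walksFrom k c ≡ 2 ^ k
  walksFrom-short k c c+k<j = begin
    walksFrom k c
      ≡⟨ ∑ᵂ-∑ k j (λ w → hit (run (just c) w)) ⟨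
    ∑ᵂ k (λ w → ∑ j (hit (run (just c) w)))
      ≡⟨ ∑ᵂ-cong k (λ w ∣w∣ → alive c w (subst (λ ℓ → c + ℓ < j) (sym ∣w∣) c+k<j)) ⟩
    ∑ᵂ k (λ _ → 1)
      ≡⟨ ∑ᵂ-const k 1 ⟩
    2 ^ k * 1
      ≡⟨ *-identityʳ _ ⟩
    2 ^ k ∎

  lucas-initial : ∀ m → 1 ≤ m → m ≤ j → lucas m + 1 ≡ 2 ^ m
  lucas-initial m 1≤m m≤j = begin
    lucas m + 1
      ≡⟨ cong (_+ 1) (lucas-resetWalks m 1≤m) ⟩
    ∑ j (λ c → resetWalks (m ∸ c) c) + 1
      ≡⟨ cong (_+ 1) (∑-restrict m j _ m≤j (λ c m≤c _ → cong (λ k → resetWalks k c) (m≤n⇒m∸n≡0 m≤c))) ⟩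
    ∑ m (λ c → resetWalks (m ∸ c) c) + 1
      ≡⟨ cong (_+ 1) (∑-cong m short) ⟩
    ∑ m (λ c → 2 ^ (m ∸ suc c)) + 1
      ≡⟨ ∑-geometric m ⟩
    2 ^ m ∎
    where
    short : ∀ c → c < m → resetWalks (m ∸ c) c ≡ 2 ^ (m ∸ suc c)
    short c c<m = trans (cong (λ k → resetWalks k c) (+-∸-assoc 1 c<m))
                        (walksFrom-short (m ∸ suc c) c (≤-trans (≤-reflexive (m+[n∸m]≡n c<m)) m≤j))

  fixCount-rot : ∀ w → fixCount (rot w) ≡ fixCount w
  fixCount-rot []      = refl
  fixCount-rot (b ∷ w) = begin
    ∑ j (λ c → hit (run (just c) (w ++ [ b ])) c)
      ≡⟨ ∑-cong j (λ c _ → cong (λ x → hit x c) (run-∷ʳ (just c) w b)) ⟩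
    ∑ j (λ c → hit (step b (run (just c) w)) c)
      ≡⟨ trace-∘-comm (λ x → run x w) (step b) (run-nothing w) refl
                      (λ c c<j → run-bounded (just c) w c<j) (λ c _ → step-bounded b (just c)) ⟩
    ∑ j (λ c → hit (run (step b (just c)) w) c) ∎

  fixCount-rotate : ∀ k w → fixCount (rotate k w) ≡ fixCount w
  fixCount-rotate zero    w = refl
  fixCount-rotate (suc k) w = trans (fixCount-rotate k (rot w)) (fixCount-rot w)

  run-++-just : ∀ x u v {z} → run x (u ++ v) ≡ just z → Σ[ y ∈ ℕ ] run x u ≡ just y × run (just y) v ≡ just z
  run-++-just x u v eq with run x u in eu
  ... | nothing = contradiction (trans (sym eq) (trans (run-++ x u v) (trans (cong (λ y → run y v) eu) (run-nothing v)))) λ ()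
  ... | just y  = y , refl , trans (sym (cong (λ y → run y v) eu)) (trans (sym (run-++ x u v)) eq)

  run-false : ∀ c w {x} → run (step false (just c)) w ≡ just x → run (just (suc c)) w ≡ just x
  run-false c w eq with suc c <? j
  ... | yes _ = eq
  ... | no  _ = contradiction (trans (sym eq) (run-nothing w)) λ ()

  Resetting Shifting : Word → Set
  Resetting w = ∀ {c d x y} → run (just c) w ≡ just x → run (just d) w ≡ just y → x ≡ y
  Shifting  w = ∀ {c x} → run (just c) w ≡ just x → x ≡ c + length w

  -- A word containing `true` forgets its starting state; a word of `false`s only shifts it.
  resetting-or-shifting : ∀ w → Resetting w ⊎ Shifting w
  resetting-or-shifting []          = inj₂ λ { refl → sym (+-identityʳ _) }
  resetting-or-shifting (true ∷ w)  = inj₁ λ ex ey → just-injective (trans (sym ex) ey)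
  resetting-or-shifting (false ∷ w) with resetting-or-shifting w
  ... | inj₁ resetting = inj₁ λ {c} {d} ex ey → resetting (run-false c w ex) (run-false d w ey)
  ... | inj₂ shifting  = inj₂ λ {c} ex → trans (shifting (run-false c w ex)) (sym (+-suc c (length w)))

  Shifting-++ : ∀ u v → Shifting u → Shifting v → Shifting (u ++ v)
  Shifting-++ u v su sv {c} {x} ex with run-++-just (just c) u v ex
  ... | y , eu , ev = begin
    x                          ≡⟨ sv ev ⟩
    y + length v               ≡⟨ cong (_+ length v) (su eu) ⟩
    c + length u + length v    ≡⟨ +-assoc c (length u) _ ⟩
    c + (length u + length v)  ≡⟨ cong (c +_) (length-++ u) ⟨
    c + length (u ++ v)        ∎

  Shifting-repeat : ∀ p u → Shifting u → Shifting (repeat p u)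
  Shifting-repeat zero    u _  refl = sym (+-identityʳ _)
  Shifting-repeat (suc p) u su      = Shifting-++ u (repeat p u) su (Shifting-repeat p u su)

  Shifting⇒no-fixpoint : ∀ w c → Shifting w → 1 ≤ length w → hit (run (just c) w) c ≡ 0
  Shifting⇒no-fixpoint w@(_ ∷ _) c sw _ with run (just c) w in eq
  ... | nothing = refl
  ... | just x  = hit-other λ x≡c → m+1+n≢m c (trans (sym (sw eq)) x≡c)

  fixpoint-repeat : ∀ p u c → run (just c) u ≡ just c → run (just c) (repeat p u) ≡ just c
  fixpoint-repeat zero    u c _   = refl
  fixpoint-repeat (suc p) u c fix =
    trans (run-++ (just c) u (repeat p u)) (trans (cong (λ x → run x (repeat p u)) fix) (fixpoint-repeat p u c fix))

  hit-repeat : ∀ p u c → 1 ≤ length u → hit (run (just c) (repeat (suc p) u)) c ≡ hit (run (just c) u) c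
  hit-repeat p u c 1≤∣u∣ with resetting-or-shifting u
  ... | inj₂ su = trans (Shifting⇒no-fixpoint (repeat (suc p) u) c (Shifting-repeat (suc p) u su) 1≤∣uᵖ⁺¹∣)
                        (sym (Shifting⇒no-fixpoint u c su 1≤∣u∣))
    where
    1≤∣uᵖ⁺¹∣ : 1 ≤ length (repeat (suc p) u)
    1≤∣uᵖ⁺¹∣ = ≤-trans 1≤∣u∣ (≤-trans (m≤m+n (length u) (length (repeat p u))) (≤-reflexive (sym (length-++ u))))
  ... | inj₁ ru with run (just c) u in eq
  ...   | nothing = cong (λ x → hit x c) (trans (run-++ (just c) u (repeat p u))
                                                (trans (cong (λ x → run x (repeat p u)) eq) (run-nothing (repeat p u))))
  ...   | just x with x ≟ c
  ...     | yes refl = cong (λ y → hit y c) (fixpoint-repeat (suc p) u c eq)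
  ...     | no  x≢c  with run (just c) (repeat (suc p) u) in eq′
  ...       | nothing = sym (hit-other x≢c)
  ...       | just y with run-++-just (just c) (repeat p u) u (trans (cong (run (just c)) (sym (repeat-∷ʳ p u))) eq′)
  ...         | d , _ , ed = trans (hit-other λ y≡c → x≢c (ru eq (subst (λ z → run (just d) u ≡ just z) y≡c ed)))
                                   (sym (hit-other x≢c))

  fixCount-repeat : ∀ p u → 1 ≤ length u → fixCount (repeat (suc p) u) ≡ fixCount u
  fixCount-repeat p u 1≤∣u∣ = ∑-cong j (λ c _ → hit-repeat p u c 1≤∣u∣)

  lucas-periodic : ∀ p L → 1 ≤ L → ∑ᵂ (suc p * L) (λ w → fixCount w * 𝟙 (rotate L w ≟ᵂ w)) ≡ lucas L
  lucas-periodic p L 1≤L = begin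
    ∑ᵂ (L + p * L) (λ w → fixCount w * 𝟙 (rotate L w ≟ᵂ w))
      ≡⟨ ∑ᵂ-++ L (p * L) _ ⟩
    ∑ᵂ L (λ u → ∑ᵂ (p * L) (λ v → fixCount (u ++ v) * 𝟙 (rotate L (u ++ v) ≟ᵂ u ++ v)))
      ≡⟨ ∑ᵂ-cong L (λ u ∣u∣ → ∑ᵂ-cong (p * L) (λ v ∣v∣ → cong (fixCount (u ++ v) *_) (periodic⇔repeat u v ∣u∣ ∣v∣))) ⟩
    ∑ᵂ L (λ u → ∑ᵂ (p * L) (λ v → fixCount (u ++ v) * 𝟙 (v ≟ᵂ repeat p u)))
      ≡⟨ ∑ᵂ-cong L (λ u ∣u∣ → ∑ᵂ-delta (p * L) (λ v → fixCount (u ++ v)) (repeat p u) (length-uᵖ u ∣u∣)) ⟩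
    ∑ᵂ L (λ u → fixCount (repeat (suc p) u))
      ≡⟨ ∑ᵂ-cong L (λ u ∣u∣ → fixCount-repeat p u (subst (1 ≤_) (sym ∣u∣) 1≤L)) ⟩
    lucas L ∎
    where
    length-uᵖ : ∀ u → length u ≡ L → length (repeat p u) ≡ p * L
    length-uᵖ u ∣u∣ = trans (length-repeat p u) (cong (p *_) ∣u∣)
    periodic⇔repeat : ∀ u v → length u ≡ L → length v ≡ p * L →
                      𝟙 (rotate L (u ++ v) ≟ᵂ u ++ v) ≡ 𝟙 (v ≟ᵂ repeat p u)
    periodic⇔repeat u v refl ∣v∣ = 𝟙-⇔ (rotate (length u) (u ++ v) ≟ᵂ u ++ v) (v ≟ᵂ repeat p u)
      (λ rot≡ → commuting⇒repeat p u v ∣v∣ (trans (sym (rotate-++ u v)) rot≡))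
      (λ { refl → trans (rotate-++ u (repeat p u)) (sym (repeat-∷ʳ p u)) })

  aperiodicFix : ℕ → Word → ℕ
  aperiodicFix L w = fixCount w * 𝟙 (¬? (rotate L w ≟ᵂ w))

  fixCount-split : ∀ L w → fixCount w ≡ fixCount w * 𝟙 (rotate L w ≟ᵂ w) + aperiodicFix L w
  fixCount-split L w = begin
    fixCount w                                                       ≡⟨ *-identityʳ _ ⟨
    fixCount w * 1                                                   ≡⟨ cong (fixCount w *_) (𝟙-¬? (rotate L w ≟ᵂ w)) ⟨
    fixCount w * (𝟙 (rotate L w ≟ᵂ w) + 𝟙 (¬? (rotate L w ≟ᵂ w)))   ≡⟨ *-distribˡ-+ (fixCount w) _ _ ⟩
    fixCount w * 𝟙 (rotate L w ≟ᵂ w) + aperiodicFix L w              ∎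

  aperiodicFix-rotate : ∀ L k w → aperiodicFix L (rotate k w) ≡ aperiodicFix L w
  aperiodicFix-rotate L k w = cong₂ _*_ (fixCount-rotate k w)
    (𝟙-⇔ (¬? (rotate L (rotate k w) ≟ᵂ rotate k w)) (¬? (rotate L w ≟ᵂ w))
         (λ ¬per per → ¬per (trans (rotate-comm L k w) (cong (rotate k) per)))
         (λ ¬per per → ¬per (rotate-injective k (trans (rotate-comm k L w) per))))

  aperiodicFix-periodic : ∀ L w → rotate L w ≡ w → aperiodicFix L w ≡ 0
  aperiodicFix-periodic L w per =
    trans (cong (fixCount w *_) (𝟙-no (¬? (rotate L w ≟ᵂ w)) (λ ¬per → ¬per per))) (*-zeroʳ (fixCount w))

  lucas-congruence : ∀ {p} e r → Prime p → 1 ≤ r →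
                     Σ[ B ∈ ℕ ] lucas (p * (p ^ e * r)) ≡ lucas (p ^ e * r) + p ^ suc e * B
  lucas-congruence {p@(suc p′)} e r pp 1≤r = quotient q∣∑ , (begin
    ∑ᵂ n fixCount                                                      ≡⟨ ∑ᵂ-cong n (λ w _ → fixCount-split L w) ⟩
    ∑ᵂ n (λ w → fixCount w * 𝟙 (rotate L w ≟ᵂ w) + aperiodicFix L w)   ≡⟨ ∑ᵂ-distrib n _ (aperiodicFix L) ⟩
    ∑ᵂ n (λ w → fixCount w * 𝟙 (rotate L w ≟ᵂ w)) + ∑ᵂ n (aperiodicFix L)
      ≡⟨ cong₂ _+_ (lucas-periodic p′ L 1≤L) (_∣_.equality q∣∑) ⟩
    lucas L + quotient q∣∑ * q                                         ≡⟨ cong (lucas L +_) (*-comm (quotient q∣∑) q) ⟩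
    lucas L + q * quotient q∣∑                                         ∎)
    where
    L = p ^ e * r
    n = p * L
    q = p ^ suc e
    instance
      _ = prime⇒nonZero pp
      q≢0 : NonZero q
      q≢0 = m^n≢0 p (suc e)
    1≤L : 1 ≤ L
    1≤L = *-mono-≤ (m^n>0 p e) 1≤r
    r*q≡n : r * q ≡ n
    r*q≡n = trans (*-comm r q) (*-assoc p (p ^ e) r)
    open RotationOrbits n r q r*q≡n using (FreeOrbit; orbits-divide)
    free : ∀ w → length w ≡ n → aperiodicFix L w ≢ 0 → FreeOrbit w
    free w ∣w∣≡n ≢0 0<k k<q shift≡w = ≢0 (aperiodicFix-periodic L w (subst (λ i → rotate i w ≡ w) (*-comm r (p ^ e))
      (rotate-prime-power-period e r pp (trans ∣w∣≡n (sym r*q≡n)) 0<k k<q shift≡w)))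
    q∣∑ : q ∣ ∑ᵂ n (aperiodicFix L)
    q∣∑ = orbits-divide (aperiodicFix L) (aperiodicFix-rotate L) free

module IntegerSums where

  open import Data.Bool using (if_then_else_)
  open import Data.Integer as ℤ using (ℤ; 0ℤ; _+_; _*_; -_; _-_)
  open import Data.Integer.Tactic.RingSolver using (solve-∀)
  import Data.Integer.Properties as ℤ
  open import Data.Integer.Divisibility.Signed using (_∣_; divides; ∣m∣n⇒∣m+n)
  open import Data.List using (List; map; filter; applyUpTo)
  open import Data.Nat as ℕ using (ℕ; zero; suc; _<_; z≤n; s≤s)
  open import Relation.Nullary using (Dec; does; yes; no; ¬_; ¬?; contradiction)
  open import Relation.Unary using (Pred; Decidable)
  open import Relation.Binary.PropositionalEquality
  open RangeSum ℤ.+-0-commutativeMonoid public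

  guard : ∀ {ℓ} {P : Set ℓ} → Dec P → ℤ → ℤ
  guard d x = if does d then x else 0ℤ

  guard-yes : ∀ {ℓ} {P : Set ℓ} (d : Dec P) → P → ∀ x → guard d x ≡ x
  guard-yes (yes _) _ x = refl
  guard-yes (no ¬p) p x = contradiction p ¬p

  guard-no : ∀ {ℓ} {P : Set ℓ} (d : Dec P) → ¬ P → ∀ x → guard d x ≡ 0ℤ
  guard-no (yes p) ¬p x = contradiction p ¬p
  guard-no (no _)  _  x = refl

  guard-¬?+guard : ∀ {ℓ} {P : Set ℓ} (d : Dec P) x → x ≡ guard (¬? d) x + guard d x
  guard-¬?+guard (yes _) x = sym (ℤ.+-identityˡ x)
  guard-¬?+guard (no _)  x = sym (ℤ.+-identityʳ x)

  guard-∣ : ∀ {ℓ} {P : Set ℓ} (d : Dec P) {k x} → (P → k ∣ x) → k ∣ guard d x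
  guard-∣ (yes p) k∣x = k∣x p
  guard-∣ (no _)  _   = divides 0ℤ refl

  sumℤ-map-filter : ∀ {ℓ} {P : Pred ℕ ℓ} (P? : Decidable P) (h : ℕ → ℤ) (f : ℕ → ℕ) n →
                    sumℤ (map h (filter P? (applyUpTo f n))) ≡ ∑ n (λ i → guard (P? (f i)) (h (f i)))
  sumℤ-map-filter P? h f zero    = refl
  sumℤ-map-filter P? h f (suc n) with P? (f 0)
  ... | yes _ = cong (h (f 0) +_) (sumℤ-map-filter P? h (λ i → f (suc i)) n)
  ... | no  _ = trans (sumℤ-map-filter P? h (λ i → f (suc i)) n) (sym (ℤ.+-identityˡ _))

  ∑-neg : ∀ n (f : ℕ → ℤ) → ∑ n (λ i → - f i) ≡ - ∑ n f
  ∑-neg zero    f = refl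
  ∑-neg (suc n) f = trans (cong (- f 0 +_) (∑-neg n _)) (sym (ℤ.neg-distrib-+ (f 0) _))

  ∑-∣ : ∀ {k} n (f : ℕ → ℤ) → (∀ i → i < n → k ∣ f i) → k ∣ ∑ n f
  ∑-∣ zero    f _   = divides 0ℤ refl
  ∑-∣ (suc n) f k∣f = ∣m∣n⇒∣m+n (k∣f 0 (s≤s z≤n)) (∑-∣ n _ (λ i i<n → k∣f (suc i) (s≤s i<n)))

  guard-*-difference : ∀ {ℓ} {P : Set ℓ} (d : Dec P) a x y → guard d (a * x) - guard d (a * y) ≡ guard d (a * (x - y))
  guard-*-difference (yes _) a x y = *-distribˡ-- a x y
    where
    *-distribˡ-- : ∀ a x y → a * x - a * y ≡ a * (x - y)
    *-distribˡ-- = solve-∀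
  guard-*-difference (no _)  a x y = refl

module AffineLucas (j : ℕ) (0<j : 0 < j) (k m : ℤ) where

  open import Data.Nat as ℕ using (zero; suc; _≤_; _∸_; z≤n; s≤s; _≤?_)
  import Data.Nat.Properties as ℕ
  open import Data.Nat.Primality using (Prime; prime⇒nonZero)
  open import Data.Integer as ℤ using (+_; _+_; _*_; _-_)
  import Data.Integer.Properties as ℤ
  open import Data.Integer.Divisibility.Signed using (divides; ∣n⇒∣m*n) renaming (_∣_ to _∣ℤ_)
  open import Data.Integer.Tactic.RingSolver using (solve-∀)
  open import Data.List using (List; []; _∷_; take)
  open import Data.Product using (_,_)
  open import Relation.Nullary using (yes; no)
  open import Relation.Binary.PropositionalEquality
  open ≡-Reasoning
  open NatSums using (∑)
  open LucasAutomaton j 0<j using (lucas; lucas-rec; lucas-initial; lucas-congruence)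
  open IntegerSums using () renaming (∑ to ∑ᶻ)

  affine : ℕ → ℤ
  affine n = m * + lucas n + k

  affineValues : ℕ → List ℤ
  affineValues zero    = []
  affineValues (suc n) = affine (suc n) ∷ affineValues n

  sumℤ-take-affineValues : ∀ i n → i ≤ n → sumℤ (take i (affineValues n)) ≡ ∑ᶻ i (λ t → affine (n ∸ t))
  sumℤ-take-affineValues zero    n       _         = refl
  sumℤ-take-affineValues (suc i) (suc n) (s≤s i≤n) = cong (λ x → affine (suc n) + x) (sumℤ-take-affineValues i n i≤n)

  ∑-affine : ∀ i (f : ℕ → ℕ) → ∑ᶻ i (λ t → m * + f t + k) ≡ m * + ∑ i f + + i * k
  ∑-affine zero    f = zero-case m k
    where
    zero-case : ∀ m k → + 0 ≡ m * + 0 + + 0 * k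
    zero-case = solve-∀
  ∑-affine (suc i) f = begin
    m * + f 0 + k + ∑ᶻ i (λ t → m * + f (suc t) + k)
      ≡⟨ cong (λ x → m * + f 0 + k + x) (∑-affine i (λ t → f (suc t))) ⟩
    m * + f 0 + k + (m * + S + + i * k)
      ≡⟨ regroup m k (+ f 0) (+ S) (+ i) ⟩
    m * (+ f 0 + + S) + (+ 1 + + i) * k
      ≡⟨ cong₂ (λ u v → m * u + v * k) (ℤ.pos-+ (f 0) S) (ℤ.pos-+ 1 i) ⟨
    m * + (f 0 ℕ.+ S) + + suc i * k ∎
    where
    S = ∑ i (λ t → f (suc t))
    regroup : ∀ m k x y z → m * x + k + (m * y + z * k) ≡ m * (x + y) + (+ 1 + z) * k
    regroup = solve-∀

  φvals≡affineValues : ∀ n → φvals j k m n ≡ affineValues n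
  φvals≡affineValues zero = refl
  φvals≡affineValues (suc n) with suc n ≤? j
  ... | yes n+1≤j = cong₂ _∷_ initial (φvals≡affineValues n)
    where
    initial : m * (+ (2 ℕ.^ suc n) - + 1) + k ≡ affine (suc n)
    initial = begin
      m * (+ (2 ℕ.^ suc n) - + 1) + k
        ≡⟨ cong (λ x → m * (+ x - + 1) + k) (lucas-initial (suc n) (s≤s z≤n) n+1≤j) ⟨
      m * (+ (lucas (suc n) ℕ.+ 1) - + 1) + k
        ≡⟨ cong (λ x → m * (x - + 1) + k) (ℤ.pos-+ (lucas (suc n)) 1) ⟩
      m * (+ lucas (suc n) + + 1 - + 1) + k
        ≡⟨ cancel m k (+ lucas (suc n)) ⟩
      affine (suc n) ∎
      where
      cancel : ∀ m k x → m * (x + + 1 - + 1) + k ≡ m * x + k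
      cancel = solve-∀
  ... | no n+1≰j = cong₂ _∷_ recurrence (φvals≡affineValues n)
    where
    j≤n : j ≤ n
    j≤n = ℕ.≤-pred (ℕ.≰⇒> n+1≰j)
    j-1 = j ∸ 1
    recurrence : sumℤ (take j (φvals j k m n)) - + j-1 * k ≡ affine (suc n)
    recurrence = begin
      sumℤ (take j (φvals j k m n)) - + j-1 * k
        ≡⟨ cong (λ v → sumℤ (take j v) - + j-1 * k) (φvals≡affineValues n) ⟩
      sumℤ (take j (affineValues n)) - + j-1 * k
        ≡⟨ cong (_- + j-1 * k) (sumℤ-take-affineValues j n j≤n) ⟩
      ∑ᶻ j (λ t → affine (n ∸ t)) - + j-1 * k
        ≡⟨ cong (_- + j-1 * k) (∑-affine j (λ t → lucas (n ∸ t))) ⟩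
      m * + ∑ j (λ t → lucas (n ∸ t)) + + j * k - + j-1 * k
        ≡⟨ cong (λ x → m * + x + + j * k - + j-1 * k) (lucas-rec n j≤n) ⟨
      m * + lucas (suc n) + + j * k - + j-1 * k
        ≡⟨ cong (λ i → m * + lucas (suc n) + + i * k - + j-1 * k) (ℕ.m+[n∸m]≡n 0<j) ⟨
      m * + lucas (suc n) + + (1 ℕ.+ j-1) * k - + j-1 * k
        ≡⟨ cong (λ x → m * + lucas (suc n) + x * k - + j-1 * k) (ℤ.pos-+ 1 j-1) ⟩
      m * + lucas (suc n) + (+ 1 + + j-1) * k - + j-1 * k
        ≡⟨ cancel m k (+ lucas (suc n)) (+ j-1) ⟩
      affine (suc n) ∎
      where
      cancel : ∀ m k x y → m * x + (+ 1 + y) * k - y * k ≡ m * x + k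
      cancel = solve-∀

  φjkm≡affine : ∀ n → 1 ≤ n → φjkm j k m n ≡ affine n
  φjkm≡affine (suc n) _ rewrite φvals≡affineValues (suc n) = refl

  affine-congruence : ∀ {p} e r → Prime p → 1 ≤ r →
                      (+ (p ℕ.^ suc e)) ∣ℤ φjkm j k m (p ℕ.* (p ℕ.^ e ℕ.* r)) - φjkm j k m (p ℕ.^ e ℕ.* r)
  affine-congruence {p} e r pp 1≤r with B , lucas[pL]≡ ← lucas-congruence e r pp 1≤r =
    subst (+ q ∣ℤ_) (sym difference) (∣n⇒∣m*n m (divides (+ B) (trans (ℤ.pos-* q B) (ℤ.*-comm (+ q) (+ B)))))
    where
    instance _ = prime⇒nonZero pp
    q = p ℕ.^ suc e
    L = p ℕ.^ e ℕ.* r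
    1≤L : 1 ≤ L
    1≤L = ℕ.*-mono-≤ (ℕ.m^n>0 p e) 1≤r
    difference : φjkm j k m (p ℕ.* L) - φjkm j k m L ≡ m * + (q ℕ.* B)
    difference = begin
      φjkm j k m (p ℕ.* L) - φjkm j k m L
        ≡⟨ cong₂ _-_ (φjkm≡affine (p ℕ.* L) (ℕ.*-mono-≤ (ℕ.>-nonZero⁻¹ p) 1≤L)) (φjkm≡affine L 1≤L) ⟩
      (m * + lucas (p ℕ.* L) + k) - (m * + lucas L + k)
        ≡⟨ cong (λ x → (m * + x + k) - (m * + lucas L + k)) lucas[pL]≡ ⟩
      (m * + (lucas L ℕ.+ q ℕ.* B) + k) - (m * + lucas L + k)
        ≡⟨ cong (λ x → (m * x + k) - (m * + lucas L + k)) (ℤ.pos-+ (lucas L) (q ℕ.* B)) ⟩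
      (m * (+ lucas L + + (q ℕ.* B)) + k) - (m * + lucas L + k)
        ≡⟨ cancel m k (+ lucas L) (+ (q ℕ.* B)) ⟩
      m * + (q ℕ.* B) ∎
      where
      cancel : ∀ m k x y → (m * (x + y) + k) - (m * x + k) ≡ m * y
      cancel = solve-∀

module Möbius where

  open import Data.Nat
  open import Data.Nat.Properties
  open import Data.Nat.Divisibility
  open import Data.Nat.Coprimality using (coprime-divisor)
  open import Data.Nat.Primality using (Prime; prime?; prime⇒irreducible; prime⇒nonZero; euclidsLemma; ¬prime[1])
  open import Data.Integer as ℤ using (ℤ; 0ℤ; -_; -1ℤ)
  open import Data.Integer.Properties using (-1*i≡-i)
  open import Data.List using (length; filter; applyUpTo; upTo)
  open import Data.List.Membership.Propositional.Properties using (∈-upTo⁺; ∈-upTo⁻)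
  open import Data.List.Relation.Unary.All using (All; lookup; tabulate)
  open import Data.Product using (_×_; _,_)
  open import Data.Sum using (inj₁; inj₂; [_,_]′)
  open import Data.Nat.Tactic.RingSolver using (solve-∀)
  open import Relation.Nullary using (yes; no; ¬_; contradiction)
  open import Relation.Nullary.Decidable using (_×-dec_)
  open import Relation.Unary using (Pred; Decidable)
  open import Relation.Binary.PropositionalEquality
  open ≡-Reasoning
  open NatSums using (∑; ∑-cong; ∑-distrib; ∑-restrict; ∑-single; 𝟙; 𝟙-yes; 𝟙-no; 𝟙-⇔)
  open PrimePowers using (¬∣⇒coprime)

  length-filter-applyUpTo : ∀ {ℓ} {P : Pred ℕ ℓ} (P? : Decidable P) (f : ℕ → ℕ) n →
                            length (filter P? (applyUpTo f n)) ≡ ∑ n (λ i → 𝟙 (P? (f i)))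
  length-filter-applyUpTo P? f zero    = refl
  length-filter-applyUpTo P? f (suc n) with P? (f 0)
  ... | yes _ = cong suc (length-filter-applyUpTo P? (λ i → f (suc i)) n)
  ... | no  _ = length-filter-applyUpTo P? (λ i → f (suc i)) n

  SquareFree : ℕ → Set
  SquareFree d = ∀ {i} → i < d → ¬ (suc (suc i) * suc (suc i) ∣ d)

  SquareFree⇒All : ∀ {d} → SquareFree d → All (λ i → ¬ (suc (suc i) * suc (suc i) ∣ d)) (upTo d)
  SquareFree⇒All sf = tabulate (λ i∈ → sf (∈-upTo⁻ i∈))

  All⇒SquareFree : ∀ {d} → All (λ i → ¬ (suc (suc i) * suc (suc i) ∣ d)) (upTo d) → SquareFree d
  All⇒SquareFree all i<d = lookup all (∈-upTo⁺ i<d)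

  μ-squareFree : ∀ {d} → SquareFree d → μ d ≡ -1ℤ ℤ.^ ω d
  μ-squareFree {d} sf with squarefree? d
  ... | yes _   = refl
  ... | no  ¬sf = contradiction (SquareFree⇒All sf) ¬sf

  μ-notSquareFree : ∀ {d} → ¬ SquareFree d → μ d ≡ 0ℤ
  μ-notSquareFree {d} ¬sf with squarefree? d
  ... | yes sf = contradiction (λ {i} → All⇒SquareFree sf {i}) ¬sf
  ... | no  _  = refl

  square∣⇒¬SquareFree : ∀ {k d} → 2 ≤ k → .{{NonZero d}} → k * k ∣ d → ¬ SquareFree d
  square∣⇒¬SquareFree {k@(suc (suc i))} {d} (s≤s (s≤s z≤n)) k*k∣d sf = sf i<d k*k∣d
    where
    i<d : i < d
    i<d = ≤-trans (n≤1+n (suc i)) (≤-trans (m≤m*n k k) (∣⇒≤ k*k∣d))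

  μ-square∣ : ∀ {k d} → 2 ≤ k → .{{NonZero d}} → k * k ∣ d → μ d ≡ 0ℤ
  μ-square∣ 2≤k k*k∣d = μ-notSquareFree (square∣⇒¬SquareFree 2≤k k*k∣d)

  SquareFree-*ʳ : ∀ {p d} → .{{NonZero p}} → SquareFree (p * d) → SquareFree d
  SquareFree-*ʳ {p} {d} sf i<d k*k∣d = sf (≤-trans i<d (m≤n*m d p)) (∣n⇒∣m*n p k*k∣d)

  SquareFree-prime-* : ∀ {p d} → Prime p → ¬ (p ∣ d) → .{{NonZero d}} → SquareFree d → SquareFree (p * d)
  SquareFree-prime-* {p} {d} pp p∤d sf {i} _ k*k∣p*d with p ∣? suc (suc i)
  ... | yes (divides c k≡c*p) = p∤d (*-cancelˡ-∣ p (∣-trans p*p∣k*k k*k∣p*d))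
    where
    instance _ = prime⇒nonZero pp
    p*p∣k*k : p * p ∣ suc (suc i) * suc (suc i)
    p*p∣k*k = divides (c * c) (trans (cong₂ _*_ k≡c*p k≡c*p) (square c p))
      where
      square : ∀ c p → c * p * (c * p) ≡ c * c * (p * p)
      square = solve-∀
  ... | no  p∤k = square∣⇒¬SquareFree (s≤s (s≤s z≤n)) k*k∣d sf
    where
    k = suc (suc i)
    k*k∣d : k * k ∣ d
    k*k∣d = coprime-divisor (¬∣⇒coprime pp λ p∣k*k → [ p∤k , p∤k ]′ (euclidsLemma k k pp p∣k*k)) k*k∣p*d

  ω≡∑ : ∀ d → ω d ≡ ∑ (suc d) (λ q → 𝟙 (prime? q ×-dec q ∣? d))
  ω≡∑ d = length-filter-applyUpTo (λ q → prime? q ×-dec q ∣? d) (λ i → i) (suc d)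

  ω-summand : ∀ {p d} → Prime p → ¬ (p ∣ d) → ∀ q →
              𝟙 (prime? q ×-dec q ∣? p * d) ≡ 𝟙 (prime? q ×-dec q ∣? d) + 𝟙 (q ≟ p)
  ω-summand {p} {d} pp p∤d q with q ≟ p
  ... | yes refl = begin
    𝟙 (prime? p ×-dec p ∣? p * d)
      ≡⟨ 𝟙-yes (prime? p ×-dec p ∣? p * d) (pp , m∣m*n d) ⟩
    0 + 1
      ≡⟨ cong₂ _+_ (𝟙-no (prime? p ×-dec p ∣? d) (λ (_ , p∣d) → p∤d p∣d)) (𝟙-yes (p ≟ p) refl) ⟨
    𝟙 (prime? p ×-dec p ∣? d) + 𝟙 (p ≟ p) ∎
  ... | no q≢p = begin
    𝟙 (prime? q ×-dec q ∣? p * d)           ≡⟨ 𝟙-⇔ (prime? q ×-dec q ∣? p * d) (prime? q ×-dec q ∣? d) to from ⟩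
    𝟙 (prime? q ×-dec q ∣? d)               ≡⟨ +-identityʳ _ ⟨
    𝟙 (prime? q ×-dec q ∣? d) + 0           ≡⟨ cong (𝟙 (prime? q ×-dec q ∣? d) +_) (𝟙-no (q ≟ p) q≢p) ⟨
    𝟙 (prime? q ×-dec q ∣? d) + 𝟙 (q ≟ p)   ∎
    where
    to : Prime q × q ∣ p * d → Prime q × q ∣ d
    to (qp , q∣p*d) with euclidsLemma p d qp q∣p*d
    ... | inj₂ q∣d = qp , q∣d
    ... | inj₁ q∣p with prime⇒irreducible pp q∣p
    ...   | inj₁ refl = contradiction qp ¬prime[1]
    ...   | inj₂ q≡p  = contradiction q≡p q≢p
    from : Prime q × q ∣ d → Prime q × q ∣ p * d
    from (qp , q∣d) = qp , ∣n⇒∣m*n p q∣d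

  ω-prime-* : ∀ {p d} → Prime p → ¬ (p ∣ d) → .{{NonZero d}} → ω (p * d) ≡ suc (ω d)
  ω-prime-* {p} {d} pp p∤d = begin
    ω (p * d)
      ≡⟨ ω≡∑ (p * d) ⟩
    ∑ (suc (p * d)) (λ q → 𝟙 (prime? q ×-dec q ∣? p * d))
      ≡⟨ ∑-cong (suc (p * d)) (λ q _ → ω-summand pp p∤d q) ⟩
    ∑ (suc (p * d)) (λ q → 𝟙 (prime? q ×-dec q ∣? d) + 𝟙 (q ≟ p))
      ≡⟨ ∑-distrib (suc (p * d)) (λ q → 𝟙 (prime? q ×-dec q ∣? d)) (λ q → 𝟙 (q ≟ p)) ⟩
    ∑ (suc (p * d)) (λ q → 𝟙 (prime? q ×-dec q ∣? d)) + ∑ (suc (p * d)) (λ q → 𝟙 (q ≟ p))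
      ≡⟨ cong₂ _+_ (∑-restrict (suc d) (suc (p * d)) _ (s≤s (m≤n*m d p)) too-large) just-p ⟩
    ∑ (suc d) (λ q → 𝟙 (prime? q ×-dec q ∣? d)) + 1
      ≡⟨ cong (_+ 1) (ω≡∑ d) ⟨
    ω d + 1
      ≡⟨ +-comm (ω d) 1 ⟩
    suc (ω d) ∎
    where
    instance _ = prime⇒nonZero pp
    too-large : ∀ q → suc d ≤ q → q < suc (p * d) → 𝟙 (prime? q ×-dec q ∣? d) ≡ 0
    too-large q d<q _ = 𝟙-no (prime? q ×-dec q ∣? d) (λ (_ , q∣d) → <⇒≱ d<q (∣⇒≤ q∣d))
    just-p : ∑ (suc (p * d)) (λ q → 𝟙 (q ≟ p)) ≡ 1
    just-p = trans (∑-single (suc (p * d)) _ p (s≤s (m≤m*n p d)) (λ q _ q≢p → 𝟙-no (q ≟ p) q≢p)) (𝟙-yes (p ≟ p) refl)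

  μ-prime-* : ∀ {p d} → Prime p → ¬ (p ∣ d) → .{{NonZero d}} → μ (p * d) ≡ - μ d
  μ-prime-* {p} {d} pp p∤d with squarefree? d
  ... | yes sf = begin
    μ (p * d)              ≡⟨ μ-squareFree (SquareFree-prime-* pp p∤d (All⇒SquareFree sf)) ⟩
    -1ℤ ℤ.^ ω (p * d)      ≡⟨ cong (-1ℤ ℤ.^_) (ω-prime-* pp p∤d) ⟩
    -1ℤ ℤ.* -1ℤ ℤ.^ ω d    ≡⟨ -1*i≡-i _ ⟩
    - (-1ℤ ℤ.^ ω d)        ∎
  ... | no ¬sf = μ-notSquareFree {p * d} (λ sf → ¬sf (SquareFree⇒All (SquareFree-*ʳ {p} {d} sf)))
    where instance _ = prime⇒nonZero pp

module PrimePowerDivisibility where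

  open import Data.Integer as ℤ using (ℤ; 0ℤ; +_; _+_; _*_; -_; _-_)
  import Data.Integer.Properties as ℤ
  open import Data.Integer.Divisibility.Signed as ℤ∣ using () renaming (_∣_ to _∣ℤ_)
  open import Data.Nat as ℕ using (ℕ; zero; suc; _≤_; _<_; _^_; s≤s; NonZero)
  import Data.Nat.Properties as ℕ
  open import Data.Nat.DivMod using (_/_; *-/-assoc; m*n/m*o≡n/o; m≥n⇒m/n>0)
  open import Data.Nat.Divisibility
  open import Data.Nat.Coprimality using (coprime-divisor)
  open import Data.Nat.Primality using (Prime)
  open import Data.Product using (_,_; _×_)
  open import Relation.Nullary using (Dec; yes; no; ¬_; ¬?)
  open import Relation.Nullary.Decidable using (_×-dec_)
  open import Relation.Binary.PropositionalEquality
  open ≡-Reasoning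
  open IntegerSums
  open PrimePowers
  open Möbius using (μ-square∣; μ-prime-*)

  Φ₁-as-∑ : ∀ φ n → Φ₁ φ n ≡ ∑ n (λ i → guard (suc i ∣? n) (μ (suc i) * φ (n / suc i)))
  Φ₁-as-∑ φ n = sumℤ-map-filter (λ i → suc i ∣? n) (λ i → μ (suc i) * φ (n / suc i)) (λ i → i) n

  ∑-multiples : ∀ p′ N (f : ℕ → ℤ) →
                ∑ (N ℕ.* suc p′) (λ i → guard (suc p′ ∣? suc i) (f (suc i))) ≡ ∑ N (λ k → f (suc p′ ℕ.* suc k))
  ∑-multiples p′ N f = trans (∑-blocks N p _) (∑-cong N (λ k _ → block k))
    where
    p = suc p′
    last : ∀ k → suc (k ℕ.* p ℕ.+ p′) ≡ p ℕ.* suc k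
    last k = trans (sym (ℕ.+-suc (k ℕ.* p) p′)) (trans (ℕ.+-comm (k ℕ.* p) p) (ℕ.*-comm (suc k) p))
    block : ∀ k → ∑ p (λ r → guard (p ∣? suc (k ℕ.* p ℕ.+ r)) (f (suc (k ℕ.* p ℕ.+ r)))) ≡ f (p ℕ.* suc k)
    block k = begin
      ∑ p (λ r → guard (p ∣? suc (k ℕ.* p ℕ.+ r)) (f (suc (k ℕ.* p ℕ.+ r))))
        ≡⟨ ∑-single p _ p′ (ℕ.n<1+n p′) others ⟩
      guard (p ∣? suc (k ℕ.* p ℕ.+ p′)) (f (suc (k ℕ.* p ℕ.+ p′)))
        ≡⟨ cong (λ d → guard (p ∣? d) (f d)) (last k) ⟩
      guard (p ∣? p ℕ.* suc k) (f (p ℕ.* suc k))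
        ≡⟨ guard-yes (p ∣? p ℕ.* suc k) (m∣m*n (suc k)) _ ⟩
      f (p ℕ.* suc k) ∎
      where
      p≤1+r : ∀ r → p ∣ suc (k ℕ.* p ℕ.+ r) → p′ ≤ r
      p≤1+r r p∣ = ℕ.≤-pred (∣⇒≤ (∣m+n∣m⇒∣n (subst (p ∣_) (sym (ℕ.+-suc (k ℕ.* p) r)) p∣) (n∣m*n k)))
      others : ∀ r → r < p → r ≢ p′ → guard (p ∣? suc (k ℕ.* p ℕ.+ r)) (f (suc (k ℕ.* p ℕ.+ r))) ≡ 0ℤ
      others r r<p r≢p′ = guard-no (p ∣? _) (λ p∣ → r≢p′ (ℕ.≤-antisym (ℕ.≤-pred r<p) (p≤1+r r p∣))) _

  -- With n = p·N: the terms at d = p·d′ with p ∣ d′ vanish, and for p ∤ d′ the terms at d′ and p·d′ combine to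
  -- μ(d′) (φ(p·N/d′) − φ(N/d′)), which the Euler congruence makes a multiple of p^(e+1).
  module PrimePowerPart (φ : ℕ → ℤ) {p′} e {m} (pp : Prime (suc p′)) (p∤m : ¬ (suc p′ ∣ m)) (1≤m : 1 ≤ m)
    (euler : ∀ r → 1 ≤ r → + (suc p′ ^ suc e) ∣ℤ φ (suc p′ ℕ.* (suc p′ ^ e ℕ.* r)) - φ (suc p′ ^ e ℕ.* r)) where

    p N n : ℕ
    p = suc p′
    N = p ^ e ℕ.* m
    n = p ℕ.* N

    term : ℕ → ℤ
    term zero      = 0ℤ
    term d@(suc _) = μ d * φ (n / d)

    summand : ℕ → ℤ
    summand d = guard (d ∣? n) (term d)

    coprimeDivisor? : ∀ d → Dec (d ∣ N × ¬ (p ∣ d))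
    coprimeDivisor? d = d ∣? N ×-dec ¬? (p ∣? d)

    instance
      m≢0 : NonZero m
      m≢0 = ℕ.>-nonZero 1≤m
      N≢0 : NonZero N
      N≢0 = ℕ.m*n≢0 (p ^ e) m {{ℕ.m^n≢0 p e}}

    coprimeTerm : ℕ → ℤ → ℤ
    coprimeTerm k x = guard (coprimeDivisor? (suc k)) (μ (suc k) * x)

    coprime-summand : ∀ i → guard (¬? (p ∣? suc i)) (summand (suc i)) ≡ coprimeTerm i (φ (p ℕ.* (N / suc i)))
    coprime-summand i with p ∣? suc i
    ... | yes p∣d = trans (guard-no (¬? (p ∣? suc i)) (λ p∤d → p∤d p∣d) _)
                          (sym (guard-no (coprimeDivisor? (suc i)) (λ (_ , p∤d) → p∤d p∣d) _))
    ... | no  p∤d = trans (guard-yes (¬? (p ∣? suc i)) p∤d _) (divisor-summand (suc i ∣? N))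
      where
      divisor-summand : Dec (suc i ∣ N) → summand (suc i) ≡ coprimeTerm i (φ (p ℕ.* (N / suc i)))
      divisor-summand (no d∤N) = trans (guard-no (suc i ∣? n) (λ d∣n → d∤N (coprime-divisor (¬∣⇒coprime pp p∤d) d∣n)) _)
                                       (sym (guard-no (coprimeDivisor? (suc i)) (λ (d∣N , _) → d∤N d∣N) _))
      divisor-summand (yes d∣N) = begin
        summand (suc i)          ≡⟨ guard-yes (suc i ∣? n) (∣n⇒∣m*n p d∣N) _ ⟩
        μ (suc i) * φ (n / suc i)                  ≡⟨ cong (λ x → μ (suc i) * φ x) (*-/-assoc p d∣N) ⟩
        μ (suc i) * φ (p ℕ.* (N / suc i))          ≡⟨ guard-yes (coprimeDivisor? (suc i)) (d∣N , p∤d) _ ⟨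
        coprimeTerm i (φ (p ℕ.* (N / suc i)))                     ∎

    multiple-summand : ∀ k → summand (p ℕ.* suc k) ≡ - coprimeTerm k (φ (N / suc k))
    multiple-summand k with suc k ∣? N
    ... | no  d∤N = trans (guard-no (p ℕ.* suc k ∣? n) (λ pd∣pN → d∤N (*-cancelˡ-∣ p pd∣pN)) _)
                          (sym (cong -_ (guard-no (coprimeDivisor? (suc k)) (λ (d∣N , _) → d∤N d∣N) _)))
    ... | yes d∣N with p ∣? suc k
    ...   | yes p∣d = begin
      summand (p ℕ.* suc k)
        ≡⟨ guard-yes (p ℕ.* suc k ∣? n) (*-monoʳ-∣ p d∣N) _ ⟩
      μ (p ℕ.* suc k) * φ (n / (p ℕ.* suc k))
        ≡⟨ cong (_* φ (n / (p ℕ.* suc k))) (μ-square∣ (prime⇒>1 pp) (*-monoʳ-∣ p p∣d)) ⟩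
      0ℤ
        ≡⟨ cong -_ (guard-no (coprimeDivisor? (suc k)) (λ (_ , p∤d) → p∤d p∣d) _) ⟨
      - coprimeTerm k (φ (N / suc k)) ∎
    ...   | no  p∤d = begin
      summand (p ℕ.* suc k)
        ≡⟨ guard-yes (p ℕ.* suc k ∣? n) (*-monoʳ-∣ p d∣N) _ ⟩
      μ (p ℕ.* suc k) * φ (n / (p ℕ.* suc k))
        ≡⟨ cong₂ (λ x y → x * φ y) (μ-prime-* pp p∤d) (m*n/m*o≡n/o p N (suc k)) ⟩
      - μ (suc k) * φ (N / suc k)
        ≡⟨ ℤ.neg-distribˡ-* (μ (suc k)) _ ⟨
      - (μ (suc k) * φ (N / suc k))
        ≡⟨ cong -_ (guard-yes (coprimeDivisor? (suc k)) (d∣N , p∤d) _) ⟨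
      - coprimeTerm k (φ (N / suc k)) ∎

    coprime-part : ∑ n (λ i → guard (¬? (p ∣? suc i)) (summand (suc i)))
                   ≡ ∑ N (λ k → coprimeTerm k (φ (p ℕ.* (N / suc k))))
    coprime-part = trans (∑-restrict N n _ (ℕ.m≤n*m N p) beyond-N) (∑-cong N (λ i _ → coprime-summand i))
      where
      beyond-N : ∀ i → N ≤ i → i < n → guard (¬? (p ∣? suc i)) (summand (suc i)) ≡ 0ℤ
      beyond-N i N≤i _ = trans (coprime-summand i)
        (guard-no (coprimeDivisor? (suc i)) (λ (d∣N , _) → ℕ.<⇒≱ (s≤s N≤i) (∣⇒≤ d∣N)) _)

    multiple-part : ∑ n (λ i → guard (p ∣? suc i) (summand (suc i))) ≡ - ∑ N (λ k → coprimeTerm k (φ (N / suc k)))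
    multiple-part = begin
      ∑ n (λ i → guard (p ∣? suc i) (summand (suc i)))
        ≡⟨ cong (λ ℓ → ∑ ℓ (λ i → guard (p ∣? suc i) (summand (suc i)))) (ℕ.*-comm p N) ⟩
      ∑ (N ℕ.* p) (λ i → guard (p ∣? suc i) (summand (suc i)))
        ≡⟨ ∑-multiples p′ N summand ⟩
      ∑ N (λ k → summand (p ℕ.* suc k))
        ≡⟨ ∑-cong N (λ k _ → multiple-summand k) ⟩
      ∑ N (λ k → - coprimeTerm k (φ (N / suc k)))
        ≡⟨ ∑-neg N (λ k → coprimeTerm k (φ (N / suc k))) ⟩
      - ∑ N (λ k → coprimeTerm k (φ (N / suc k))) ∎

    Φ₁≡∑ : Φ₁ φ n ≡ ∑ N (λ k → coprimeTerm k (φ (p ℕ.* (N / suc k))) - coprimeTerm k (φ (N / suc k)))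
    Φ₁≡∑ = begin
      Φ₁ φ n
        ≡⟨ Φ₁-as-∑ φ n ⟩
      ∑ n (λ i → summand (suc i))
        ≡⟨ ∑-cong n (λ i _ → guard-¬?+guard (p ∣? suc i) _) ⟩
      ∑ n (λ i → guard (¬? (p ∣? suc i)) (summand (suc i)) + guard (p ∣? suc i) (summand (suc i)))
        ≡⟨ ∑-distrib n _ _ ⟩
      ∑ n (λ i → guard (¬? (p ∣? suc i)) (summand (suc i))) + ∑ n (λ i → guard (p ∣? suc i) (summand (suc i)))
        ≡⟨ cong₂ _+_ coprime-part multiple-part ⟩
      ∑ N (λ k → coprimeTerm k (φ (p ℕ.* (N / suc k)))) - ∑ N (λ k → coprimeTerm k (φ (N / suc k)))
        ≡⟨ cong (λ x → ∑ N (λ k → coprimeTerm k (φ (p ℕ.* (N / suc k)))) + x) (∑-neg N (λ k → coprimeTerm k (φ (N / suc k)))) ⟨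
      ∑ N (λ k → coprimeTerm k (φ (p ℕ.* (N / suc k)))) + ∑ N (λ k → - coprimeTerm k (φ (N / suc k)))
        ≡⟨ ∑-distrib N _ _ ⟨
      ∑ N (λ k → coprimeTerm k (φ (p ℕ.* (N / suc k))) - coprimeTerm k (φ (N / suc k))) ∎

    prime-power-∣Φ₁ : + (p ^ suc e) ∣ℤ Φ₁ φ n
    prime-power-∣Φ₁ = subst (+ (p ^ suc e) ∣ℤ_) (sym Φ₁≡∑) (∑-∣ N _ (λ k _ → summand-∣ k))
      where
      summand-∣ : ∀ k → + (p ^ suc e) ∣ℤ coprimeTerm k (φ (p ℕ.* (N / suc k))) - coprimeTerm k (φ (N / suc k))
      summand-∣ k = subst (+ (p ^ suc e) ∣ℤ_) (sym (guard-*-difference (coprimeDivisor? (suc k)) (μ (suc k)) _ _))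
                          (guard-∣ (coprimeDivisor? (suc k))
                                   (λ (d∣N , p∤d) → ℤ∣.∣n⇒∣m*n (μ (suc k)) (euler-at d∣N p∤d)))
        where
        euler-at : suc k ∣ N → ¬ (p ∣ suc k) → + (p ^ suc e) ∣ℤ φ (p ℕ.* (N / suc k)) - φ (N / suc k)
        euler-at d∣N p∤d = subst (λ x → + (p ^ suc e) ∣ℤ φ (p ℕ.* x) - φ x) (sym (*-/-assoc (p ^ e) d∣m))
                                 (euler (m / suc k) (m≥n⇒m/n>0 (∣⇒≤ d∣m)))
          where
          d∣m : suc k ∣ m
          d∣m = coprime-divisor-^ e (¬∣⇒coprime pp p∤d) d∣N

  prime-power-∣Φ₁ : ∀ (φ : ℕ → ℤ) {p} e {m} → Prime p → ¬ (p ∣ m) → 1 ≤ m →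
                    (∀ r → 1 ≤ r → + (p ^ suc e) ∣ℤ φ (p ℕ.* (p ^ e ℕ.* r)) - φ (p ^ e ℕ.* r)) →
                    + (p ^ suc e) ∣ℤ Φ₁ φ (p ^ suc e ℕ.* m)
  prime-power-∣Φ₁ φ {suc p′} e {m} pp p∤m 1≤m euler =
    subst (λ n → + (suc p′ ^ suc e) ∣ℤ Φ₁ φ n) (sym (ℕ.*-assoc (suc p′) (suc p′ ^ e) m))
          (PrimePowerPart.prime-power-∣Φ₁ φ e pp p∤m 1≤m euler)

open import Data.Nat using (suc; _^_; _≤_; _>_; z≤n; s≤s; >-nonZero)
import Data.Nat.Properties as ℕ
open import Data.Integer using (+_)
open import Data.Integer.Divisibility using (_∣_)
open import Data.Integer.Divisibility.Signed using (∣⇒∣ᵤ)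
open import Relation.Binary.PropositionalEquality using (refl; sym; trans; subst)
open PrimePowers using (prime-power-parts⇒∣)
open PrimePowerDivisibility using (prime-power-∣Φ₁)

theorem4 : (j : ℕ) (k m : ℤ) → 2 ≤ j →
    (n : ℕ) → n > 0 → (+ n) ∣ Φ₁ (φjkm j k m) n
theorem4 j k m 2≤j n n>0 = prime-power-parts⇒∣ n {{>-nonZero n>0}} λ {p} e pp p∤m P*m≡n →
  subst (λ x → + (p ^ suc e) ∣ Φ₁ φ x) P*m≡n
        (∣⇒∣ᵤ (prime-power-∣Φ₁ φ e pp p∤m (1≤m (p ^ suc e) P*m≡n) (λ r 1≤r → affine-congruence e r pp 1≤r)))
  where
  φ = φjkm j k m
  open AffineLucas j (ℕ.<-≤-trans (s≤s z≤n) 2≤j) k m using (affine-congruence)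
  1≤m : ∀ P {m} → P ℕ.* m ≡ n → 1 ≤ m
  1≤m P P*m≡n = ℕ.n≢0⇒n>0 λ { refl → ℕ.>⇒≢ n>0 (trans (sym P*m≡n) (ℕ.*-zeroʳ P)) }
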